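{- Let $G$ be a simple graph with $n$ vertices and $m$ edges that has at least one perfect 2-matching. Then the number of edge-signings $s\in\{\pm1\}^{E(G)}$ for which the signed adjacency matrix $A(s)$ is invertible is at least $2^{m-n}/n!$.
   Context: Let $A$ be the adjacency matrix of $G$. For $s\in\{\pm1\}^{E(G)}$, the signed adjacency matrix $A(s)$ is the $n\times n$ symmetric matrix with $A(s)[i,j]=A(s)[j,i]=s(\{i,j\})$ if $\{i,j\}$ is an edge of $G$ and $0$ otherwise. A perfect 2-matching in a graph with edge set $E$ is an assignment $x:E\to\{0,1,2\}$ such that $\sum_{e\in\delta(v)}x_e=2$ for every vertex $v$, where $\delta(v)$ is the set of edges incident to $v$. -}

module Defs where

open import Data.Nat as ℕ using (ℕ; zero; suc; _≤_)
open import Data.Integer as ℤ using (ℤ; +_; -_)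
open import Data.Fin using (Fin; zero; suc; punchIn; toℕ; _≟_)
open import Data.Bool using (Bool; true; false; if_then_else_)
open import Data.List using (List; []; _∷_; _++_; map; length; filter)
open import Data.Sum using (_⊎_)
open import Data.Product using (_×_; _,_; proj₁; proj₂; Σ)
open import Relation.Nullary using (¬_; Dec; yes; no; ¬?)
open import Relation.Binary.PropositionalEquality using (_≡_; _≢_)

sumℤ : ∀ n → (Fin n → ℤ) → ℤ
sumℤ zero    f = + 0
sumℤ (suc n) f = f zero ℤ.+ sumℤ n (λ i → f (suc i))

sumℕ : ∀ n → (Fin n → ℕ) → ℕ
sumℕ zero    f = 0
sumℕ (suc n) f = f zero ℕ.+ sumℕ n (λ i → f (suc i))

Matrix : ℕ → Set
Matrix n = Fin n → Fin n → ℤ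

signℤ : ℕ → ℤ
signℤ zero = + 1
signℤ (suc k) = - signℤ k

det : ∀ n → Matrix n → ℤ
det zero    M = + 1
det (suc n) M =
  sumℤ (suc n) (λ j → signℤ (toℕ j) ℤ.* (M zero j ℤ.* det n (λ i k → M (suc i) (punchIn j k))))

-- An integer matrix is invertible (over ℚ, equivalently over ℝ) iff det ≠ 0.
Invertible : ∀ {n} → Matrix n → Set
Invertible {n} M = det n M ≢ + 0

record SimpleGraph (n m : ℕ) : Set where
  field
    ends      : Fin m → Fin n × Fin n
    noLoops   : ∀ e → proj₁ (ends e) ≢ proj₂ (ends e)
    noMulti   : ∀ e e' → e ≢ e' →
                ¬ ((proj₁ (ends e) ≡ proj₁ (ends e') × proj₂ (ends e) ≡ proj₂ (ends e'))
                   ⊎ (proj₁ (ends e) ≡ proj₂ (ends e') × proj₂ (ends e) ≡ proj₁ (ends e')))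
open SimpleGraph public

⌊_⌋ : ∀ {P : Set} → Dec P → Bool
⌊ yes _ ⌋ = true
⌊ no _ ⌋  = false

incident : ∀ {n m} → SimpleGraph n m → Fin m → Fin n → Bool
incident G e v with ⌊ proj₁ (ends G e) ≟ v ⌋ | ⌊ proj₂ (ends G e) ≟ v ⌋
... | false | false = false
... | _     | _     = true

joins : ∀ {n m} → SimpleGraph n m → Fin m → Fin n → Fin n → Bool
joins G e i j with ⌊ proj₁ (ends G e) ≟ i ⌋ | ⌊ proj₂ (ends G e) ≟ j ⌋
                 | ⌊ proj₁ (ends G e) ≟ j ⌋ | ⌊ proj₂ (ends G e) ≟ i ⌋
... | true | true | _    | _    = true
... | _    | _    | true | true = true
... | _    | _    | _    | _    = false

Signing : ℕ → Set
Signing m = Fin m → Bool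

signVal : Bool → ℤ
signVal true  = + 1
signVal false = - (+ 1)

signedAdj : ∀ {n m} → SimpleGraph n m → Signing m → Matrix n
signedAdj {n} {m} G s i j =
  sumℤ m (λ e → if joins G e i j then signVal (s e) else + 0)

PerfectTwoMatching : ∀ {n m} → SimpleGraph n m → Set
PerfectTwoMatching {n} {m} G =
  Σ (Fin m → ℕ) λ x →
    (∀ e → x e ≤ 2) ×
    (∀ v → sumℕ m (λ e → if incident G e v then x e else 0) ≡ 2)

allSignings : ∀ m → List (Signing m)
allSignings zero    = (λ ()) ∷ []
allSignings (suc m) =
  map (λ s → λ { zero → true  ; (suc e) → s e }) (allSignings m) ++
  map (λ s → λ { zero → false ; (suc e) → s e }) (allSignings m)

numInvertibleSignings : ∀ {n m} → SimpleGraph n m → ℕ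
numInvertibleSignings {n} {m} G =
  length (filter (λ s → ¬? (det n (signedAdj G s) ℤ.≟ + 0)) (allSignings m))

-- Expanding along the first row, det A(s) is a polynomial of degree at most n in the signs, and a
-- function on {±1}^m of degree at most d that does not vanish identically is nonzero at 2^(m-d) points
-- or more (split on the first sign: either both halves agree, or their difference has smaller degree).
-- This gives 2^m ≤ count · 2^n.
--
-- It remains to see that det A(s) does not vanish identically. A perfect 2-matching is the union of the
-- cycles of a permutation σ that moves every vertex along an edge of G. By the Leibniz formula, the
-- Fourier coefficient of det A(s) at the set T of edges that σ traverses once is 2^m times the sum of
-- sgn π over the permutations π along edges of G traversing exactly the edges in T once. Such π have the
-- same cycles of length ≥ 3 as σ up to orientation and no fixed points, hence the sign of σ, so the
-- coefficient is nonzero.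

module Submission where

open import Defs
open import Data.Nat using (ℕ)

module NonzeroCount where

  open import Data.Nat using (ℕ; suc; _+_; _≤_; z≤n; s≤s)
  import Data.Nat.Properties as ℕ
  open import Data.Integer using (ℤ; +_; -_; _-_; _≟_)
  open import Data.List using (List; []; _∷_; _++_; map; length; filter)
  import Data.List.Properties as List
  open import Data.Empty using (⊥-elim)
  open import Data.List.Relation.Unary.All using (All; []; _∷_)
  open import Data.Product using (_,_)
  open import Data.Sum using (_⊎_; inj₁; inj₂)
  open import Function using (_∘′_)
  open import Relation.Nullary using (yes; no; ¬?)
  open import Relation.Binary.PropositionalEquality

  #nonzero : ∀ {A : Set} → (A → ℤ) → List A → ℕ
  #nonzero f xs = length (filter (λ x → ¬? (f x ≟ + 0)) xs)

  module _ {A : Set} where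

    all-zero-or-#nonzero-positive : ∀ (f : A → ℤ) xs → All (λ x → f x ≡ + 0) xs ⊎ 1 ≤ #nonzero f xs
    all-zero-or-#nonzero-positive f [] = inj₁ []
    all-zero-or-#nonzero-positive f (x ∷ xs) with f x ≟ + 0 | all-zero-or-#nonzero-positive f xs
    ... | no _    | _          = inj₂ (s≤s z≤n)
    ... | yes fx≡0 | inj₁ rest = inj₁ (fx≡0 ∷ rest)
    ... | yes _   | inj₂ pos   = inj₂ pos

    #nonzero-++ : ∀ (f : A → ℤ) xs ys → #nonzero f (xs ++ ys) ≡ #nonzero f xs + #nonzero f ys
    #nonzero-++ f xs ys = trans (cong length (List.filter-++ _ xs ys)) (List.length-++ (filter _ xs))

    #nonzero-map : ∀ {B : Set} (f : B → ℤ) (k : A → B) xs → #nonzero f (map k xs) ≡ #nonzero (λ x → f (k x)) xs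
    #nonzero-map f k [] = refl
    #nonzero-map f k (x ∷ xs) with f (k x) ≟ + 0
    ... | yes _ = #nonzero-map f k xs
    ... | no _ = cong suc (#nonzero-map f k xs)

    #nonzero-cong : ∀ {f g : A → ℤ} → f ≗ g → ∀ xs → #nonzero f xs ≡ #nonzero g xs
    #nonzero-cong f≗g xs =
      cong length (List.filter-≐ _ _ ((λ f≢0 → f≢0 ∘′ trans (f≗g _)) , (λ g≢0 → g≢0 ∘′ trans (sym (f≗g _)))) xs)

    #nonzero-sub : ∀ (f g : A → ℤ) xs → #nonzero (λ x → f x - g x) xs ≤ #nonzero f xs + #nonzero g xs
    #nonzero-sub f g [] = z≤n
    #nonzero-sub f g (x ∷ xs) with ih ← #nonzero-sub f g xs | f x ≟ + 0 | g x ≟ + 0 | (f x - g x) ≟ + 0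
    ... | yes _   | yes _   | yes _ = ih
    ... | yes f≡0 | yes g≡0 | no f-g≢0 = ⊥-elim (f-g≢0 (cong₂ _-_ f≡0 g≡0))
    ... | yes _   | no _    | yes _ = ℕ.≤-trans ih (ℕ.+-monoʳ-≤ _ (ℕ.n≤1+n _))
    ... | yes _   | no _    | no _  = ℕ.≤-trans (s≤s ih) (ℕ.≤-reflexive (sym (ℕ.+-suc _ _)))
    ... | no _    | yes _   | yes _ = ℕ.≤-trans ih (ℕ.n≤1+n _)
    ... | no _    | yes _   | no _  = s≤s ih
    ... | no _    | no _    | yes _ = ℕ.≤-trans ih (ℕ.+-mono-≤ (ℕ.n≤1+n _) (ℕ.n≤1+n _))
    ... | no _    | no _    | no _  = s≤s (ℕ.≤-trans ih (ℕ.+-monoʳ-≤ _ (ℕ.n≤1+n _)))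

module BooleanCube where

  open import Data.Nat as ℕ using (ℕ; zero; suc; _^_; _≤_)
  import Data.Nat.Properties as ℕ
  import Data.Nat.Tactic.RingSolver as ℕ-Solver
  open import Data.Integer using (ℤ; +_; _+_; _-_; _*_)
  import Data.Integer.Properties as ℤ
  open import Data.Integer.Tactic.RingSolver using (solve-∀)
  open import Data.Bool using (Bool; true; false)
  open import Data.Fin using (Fin; zero; suc)
  open import Data.List using (_++_; map)
  open import Data.Vec.Functional using (_∷_)
  open import Data.Vec.Functional.Properties using (∷-cong)
  import Data.List.Relation.Unary.All as All
  open NonzeroCount
  open import Data.Product using (_×_; _,_)
  open import Data.Sum using (_⊎_; inj₁; inj₂)
  open import Data.Unit using (⊤; tt)
  open import Function using (_∘_)
  open import Relation.Binary.Core using (_Preserves_⟶_)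
  open import Relation.Binary.PropositionalEquality

  private
    variable
      m : ℕ

  Vanishes : (Signing m → ℤ) → Set
  Vanishes f = ∀ s → f s ≡ + 0

  _↾_ : (Signing (suc m) → ℤ) → Bool → Signing m → ℤ
  (f ↾ b) s = f (b ∷ s)

  ∂ : (Signing (suc m) → ℤ) → Signing m → ℤ
  ∂ f s = f (true ∷ s) - f (false ∷ s)

  -- The multilinear polynomial representing f has degree < d.
  DegreeBelow : ℕ → (Signing m → ℤ) → Set
  DegreeBelow         zero    f = Vanishes f
  DegreeBelow {zero}  (suc d) f = ⊤
  DegreeBelow {suc m} (suc d) f =
    DegreeBelow (suc d) (f ↾ true) × DegreeBelow (suc d) (f ↾ false) × DegreeBelow d (∂ f)

  DegreeBelow-cong : ∀ d {f g : Signing m → ℤ} → f ≗ g → DegreeBelow d f → DegreeBelow d g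
  DegreeBelow-cong zero f≗g f≗0 s = trans (sym (f≗g s)) (f≗0 s)
  DegreeBelow-cong {zero} (suc d) f≗g _ = tt
  DegreeBelow-cong {suc m} (suc d) f≗g (D⁺ , D⁻ , D∂) =
    DegreeBelow-cong (suc d) (f≗g ∘ (true ∷_)) D⁺ ,
    DegreeBelow-cong (suc d) (f≗g ∘ (false ∷_)) D⁻ ,
    DegreeBelow-cong d (λ s → cong₂ _-_ (f≗g (true ∷ s)) (f≗g (false ∷ s))) D∂

  Vanishes⇒DegreeBelow : ∀ d {f : Signing m → ℤ} → Vanishes f → DegreeBelow d f
  Vanishes⇒DegreeBelow zero f≗0 = f≗0
  Vanishes⇒DegreeBelow {zero} (suc d) f≗0 = tt
  Vanishes⇒DegreeBelow {suc m} (suc d) f≗0 =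
    Vanishes⇒DegreeBelow (suc d) (f≗0 ∘ (true ∷_)) ,
    Vanishes⇒DegreeBelow (suc d) (f≗0 ∘ (false ∷_)) ,
    Vanishes⇒DegreeBelow d (λ s → cong₂ _-_ (f≗0 (true ∷ s)) (f≗0 (false ∷ s)))

  const-DegreeBelow : ∀ d (c : ℤ) → DegreeBelow {m} (suc d) (λ _ → c)
  const-DegreeBelow {zero} d c = tt
  const-DegreeBelow {suc m} d c =
    const-DegreeBelow d c , const-DegreeBelow d c , Vanishes⇒DegreeBelow d (λ _ → ℤ.+-inverseʳ c)

  coordinate-DegreeBelow : (e : Fin m) → DegreeBelow 2 (λ s → signVal (s e))
  coordinate-DegreeBelow zero =
    const-DegreeBelow 1 _ , const-DegreeBelow 1 _ , const-DegreeBelow 0 _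
  coordinate-DegreeBelow (suc e) =
    coordinate-DegreeBelow e , coordinate-DegreeBelow e ,
    Vanishes⇒DegreeBelow 1 (λ s → ℤ.+-inverseʳ (signVal (s e)))

  +-DegreeBelow : ∀ d {f g : Signing m → ℤ} →
    DegreeBelow d f → DegreeBelow d g → DegreeBelow d (λ s → f s + g s)
  +-DegreeBelow zero f≗0 g≗0 s = cong₂ _+_ (f≗0 s) (g≗0 s)
  +-DegreeBelow {zero} (suc d) _ _ = tt
  +-DegreeBelow {suc m} (suc d) {f} {g} (F⁺ , F⁻ , F∂) (G⁺ , G⁻ , G∂) =
    +-DegreeBelow (suc d) F⁺ G⁺ , +-DegreeBelow (suc d) F⁻ G⁻ ,
    DegreeBelow-cong d ∂-+ (+-DegreeBelow d F∂ G∂)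
    where
    ∂-+ : ∀ s → ∂ f s + ∂ g s ≡ ∂ (λ s → f s + g s) s
    ∂-+ s = sub-+-sub (f (true ∷ s)) (f (false ∷ s)) (g (true ∷ s)) (g (false ∷ s))
      where
      sub-+-sub : ∀ a b c d → (a - b) + (c - d) ≡ (a + c) - (b + d)
      sub-+-sub = solve-∀

  *-DegreeBelow : ∀ a b {f g : Signing m → ℤ} →
    DegreeBelow a f → DegreeBelow (suc b) g → DegreeBelow (a ℕ.+ b) (λ s → f s * g s)
  *-DegreeBelow zero b {f} {g} f≗0 _ =
    Vanishes⇒DegreeBelow b (λ s → trans (cong (_* g s) (f≗0 s)) (ℤ.*-zeroˡ (g s)))
  *-DegreeBelow {zero} (suc a) b _ _ = tt
  *-DegreeBelow {suc m} (suc a) b {f} {g} (F⁺ , F⁻ , F∂) (G⁺ , G⁻ , G∂) =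
    *-DegreeBelow (suc a) b F⁺ G⁺ , *-DegreeBelow (suc a) b F⁻ G⁻ ,
    DegreeBelow-cong (a ℕ.+ b) ∂-* (+-DegreeBelow (a ℕ.+ b) (*-DegreeBelow a b F∂ G⁺) f⁻∂g)
    where
    ∂-* : ∀ s → ∂ f s * g (true ∷ s) + f (false ∷ s) * ∂ g s ≡ ∂ (λ s → f s * g s) s
    ∂-* s = Leibniz-rule (f (true ∷ s)) (f (false ∷ s)) (g (true ∷ s)) (g (false ∷ s))
      where
      Leibniz-rule : ∀ a b c d → (a - b) * c + b * (c - d) ≡ a * c - b * d
      Leibniz-rule = solve-∀
    f⁻∂g : DegreeBelow (a ℕ.+ b) (λ s → f (false ∷ s) * ∂ g s)
    f⁻∂g = subst (λ k → DegreeBelow k (λ s → f (false ∷ s) * ∂ g s)) (ℕ.+-comm b a)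
             (DegreeBelow-cong (b ℕ.+ a) (λ s → ℤ.*-comm (∂ g s) (f (false ∷ s))) (*-DegreeBelow b a G∂ F⁻))

  sum-DegreeBelow : ∀ d k (F : Fin k → Signing m → ℤ) →
    (∀ j → DegreeBelow d (F j)) → DegreeBelow d (λ s → sumℤ k (λ j → F j s))
  sum-DegreeBelow d zero F _ = Vanishes⇒DegreeBelow d (λ _ → refl)
  sum-DegreeBelow d (suc k) F D =
    +-DegreeBelow d (D zero) (sum-DegreeBelow d k (F ∘ suc) (D ∘ suc))

  count : (Signing m → ℤ) → ℕ
  count {m} f = #nonzero f (allSignings m)

  module _ {f : Signing (suc m) → ℤ} (ext : f Preserves _≗_ ⟶ _≡_) where

    ↾-Preserves : ∀ b → (f ↾ b) Preserves _≗_ ⟶ _≡_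
    ↾-Preserves b s≗t = ext (∷-cong refl s≗t)

    ∂-Preserves : ∂ f Preserves _≗_ ⟶ _≡_
    ∂-Preserves s≗t = cong₂ _-_ (↾-Preserves true s≗t) (↾-Preserves false s≗t)

    private
      #nonzero-halves : (k₁ k₂ : Signing m → Signing (suc m)) →
        (∀ s → k₁ s ≗ true ∷ s) → (∀ s → k₂ s ≗ false ∷ s) →
        #nonzero f (map k₁ (allSignings m) ++ map k₂ (allSignings m)) ≡ count (f ↾ true) ℕ.+ count (f ↾ false)
      #nonzero-halves k₁ k₂ k₁≗ k₂≗ = trans (#nonzero-++ f (map k₁ (allSignings m)) (map k₂ (allSignings m)))
        (cong₂ ℕ._+_ (trans (#nonzero-map f k₁ (allSignings m)) (#nonzero-cong (ext ∘ k₁≗) (allSignings m)))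
                     (trans (#nonzero-map f k₂ (allSignings m)) (#nonzero-cong (ext ∘ k₂≗) (allSignings m))))

    count-∷ : count f ≡ count (f ↾ true) ℕ.+ count (f ↾ false)
    count-∷ = #nonzero-halves _ _ (λ _ → ∷-cong refl λ _ → refl) (λ _ → ∷-cong refl λ _ → refl)

    Vanishes-∷ : Vanishes (f ↾ true) → Vanishes (f ↾ false) → Vanishes f
    Vanishes-∷ f⁺≗0 f⁻≗0 s with s zero in eq
    ... | true = trans (ext (∷-cong eq λ _ → refl)) (f⁺≗0 (s ∘ suc))
    ... | false = trans (ext (∷-cong eq λ _ → refl)) (f⁻≗0 (s ∘ suc))

    count-∂-bound : ∀ d → 2 ^ m ≤ count (∂ f) ℕ.* 2 ^ d → 2 ^ suc m ≤ count f ℕ.* 2 ^ suc d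
    count-∂-bound d bound = begin
      2 ℕ.* 2 ^ m                     ≤⟨ ℕ.*-monoʳ-≤ 2 bound ⟩
      2 ℕ.* (count (∂ f) ℕ.* 2 ^ d)   ≤⟨ ℕ.*-monoʳ-≤ 2 (ℕ.*-monoˡ-≤ (2 ^ d) ∂-count) ⟩
      2 ℕ.* ((c⁺ ℕ.+ c⁻) ℕ.* 2 ^ d)   ≡⟨ swap-2 (c⁺ ℕ.+ c⁻) (2 ^ d) ⟩
      (c⁺ ℕ.+ c⁻) ℕ.* (2 ℕ.* 2 ^ d)   ≡⟨ cong (ℕ._* 2 ^ suc d) count-∷ ⟨
      count f ℕ.* 2 ^ suc d           ∎
      where
      open ℕ.≤-Reasoning
      c⁺ = count (f ↾ true)
      c⁻ = count (f ↾ false)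
      ∂-count : count (∂ f) ≤ c⁺ ℕ.+ c⁻
      ∂-count = #nonzero-sub (f ↾ true) (f ↾ false) (allSignings m)
      swap-2 : ∀ c k → 2 ℕ.* (c ℕ.* k) ≡ c ℕ.* (2 ℕ.* k)
      swap-2 = ℕ-Solver.solve-∀

    vanishing-∂-doubles : ∀ d → Vanishes (∂ f) →
      Vanishes (f ↾ true) ⊎ 2 ^ m ≤ count (f ↾ true) ℕ.* 2 ^ d → Vanishes f ⊎ 2 ^ suc m ≤ count f ℕ.* 2 ^ d
    vanishing-∂-doubles d ∂f≗0 (inj₁ f⁺≗0) = inj₁ (Vanishes-∷ f⁺≗0 λ s → trans (f⁻≗f⁺ s) (f⁺≗0 s))
      where
      f⁻≗f⁺ : ∀ s → f (false ∷ s) ≡ f (true ∷ s)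
      f⁻≗f⁺ s = sym (ℤ.i-j≡0⇒i≡j _ _ (∂f≗0 s))
    vanishing-∂-doubles d ∂f≗0 (inj₂ bound) = inj₂ (begin
      2 ℕ.* 2 ^ m             ≤⟨ ℕ.*-monoʳ-≤ 2 bound ⟩
      2 ℕ.* (c⁺ ℕ.* 2 ^ d)    ≡⟨ double-* c⁺ (2 ^ d) ⟩
      (c⁺ ℕ.+ c⁺) ℕ.* 2 ^ d   ≡⟨ cong (λ c → (c⁺ ℕ.+ c) ℕ.* 2 ^ d) (#nonzero-cong f⁺≗f⁻ (allSignings m)) ⟩
      (c⁺ ℕ.+ c⁻) ℕ.* 2 ^ d   ≡⟨ cong (ℕ._* 2 ^ d) count-∷ ⟨
      count f ℕ.* 2 ^ d       ∎)
      where
      open ℕ.≤-Reasoning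
      c⁺ = count (f ↾ true)
      c⁻ = count (f ↾ false)
      f⁺≗f⁻ : ∀ s → f (true ∷ s) ≡ f (false ∷ s)
      f⁺≗f⁻ s = ℤ.i-j≡0⇒i≡j _ _ (∂f≗0 s)
      double-* : ∀ c k → 2 ℕ.* (c ℕ.* k) ≡ (c ℕ.+ c) ℕ.* k
      double-* = ℕ-Solver.solve-∀

  vanishes⊎count-bound : ∀ d (f : Signing m → ℤ) → f Preserves _≗_ ⟶ _≡_ → DegreeBelow (suc d) f →
    Vanishes f ⊎ 2 ^ m ≤ count f ℕ.* 2 ^ d
  vanishes⊎count-bound {zero} d f ext _ with all-zero-or-#nonzero-positive f (allSignings 0)
  ... | inj₁ f∅≡0 = inj₁ (λ s → trans (ext (λ ())) (All.head f∅≡0))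
  ... | inj₂ 1≤count = inj₂ (ℕ.≤-trans 1≤count (ℕ.m≤m*n (count f) (2 ^ d) {{ℕ.m^n≢0 2 d}}))
  vanishes⊎count-bound {suc m} zero f ext (D⁺ , _ , ∂f≗0) =
    vanishing-∂-doubles ext zero ∂f≗0 (vanishes⊎count-bound zero (f ↾ true) (↾-Preserves ext true) D⁺)
  vanishes⊎count-bound {suc m} (suc d) f ext (D⁺ , _ , D∂) with vanishes⊎count-bound d (∂ f) (∂-Preserves ext) D∂
  ... | inj₁ ∂f≗0 =
    vanishing-∂-doubles ext (suc d) ∂f≗0 (vanishes⊎count-bound (suc d) (f ↾ true) (↾-Preserves ext true) D⁺)
  ... | inj₂ bound = inj₂ (count-∂-bound ext d bound)

module Sums where

  open import Data.Nat using (zero; suc)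
  open import Data.Integer using (ℤ; +_; _+_; _*_; 0ℤ; _≤_; _<_)
  import Data.Integer.Properties as ℤ
  open import Data.Fin using (Fin; zero; suc)
  open import Function using (_∘_)
  open import Relation.Binary.PropositionalEquality

  sumℤ-cong : ∀ n {f g : Fin n → ℤ} → f ≗ g → sumℤ n f ≡ sumℤ n g
  sumℤ-cong zero f≗g = refl
  sumℤ-cong (suc n) f≗g = cong₂ _+_ (f≗g zero) (sumℤ-cong n (f≗g ∘ suc))

  *-distribˡ-sumℤ : ∀ n a (f : Fin n → ℤ) → a * sumℤ n f ≡ sumℤ n (λ i → a * f i)
  *-distribˡ-sumℤ zero a f = ℤ.*-zeroʳ a
  *-distribˡ-sumℤ (suc n) a f =
    trans (ℤ.*-distribˡ-+ a (f zero) (sumℤ n (f ∘ suc))) (cong (λ x → a * f zero + x) (*-distribˡ-sumℤ n a (f ∘ suc)))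


  sumℤ-zeros : ∀ n → sumℤ n (λ _ → + 0) ≡ + 0
  sumℤ-zeros zero = refl
  sumℤ-zeros (suc n) = trans (ℤ.+-identityˡ _) (sumℤ-zeros n)

  sumℤ-nonneg : ∀ n (f : Fin n → ℤ) → (∀ i → 0ℤ ≤ f i) → 0ℤ ≤ sumℤ n f
  sumℤ-nonneg zero f _ = ℤ.≤-refl
  sumℤ-nonneg (suc n) f f≥0 = ℤ.+-mono-≤ (f≥0 zero) (sumℤ-nonneg n (f ∘ suc) (f≥0 ∘ suc))

  sumℤ-positive : ∀ n (f : Fin n → ℤ) → (∀ i → 0ℤ ≤ f i) → ∀ i → 0ℤ < f i → 0ℤ < sumℤ n f
  sumℤ-positive (suc n) f f≥0 zero f₀>0 = ℤ.+-mono-<-≤ f₀>0 (sumℤ-nonneg n (f ∘ suc) (f≥0 ∘ suc))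
  sumℤ-positive (suc n) f f≥0 (suc i) fᵢ>0 = ℤ.+-mono-≤-< (f≥0 zero) (sumℤ-positive n (f ∘ suc) (f≥0 ∘ suc) i fᵢ>0)

module Determinant where

  open import Data.Nat using (ℕ; zero; suc)
  open import Data.Integer using (ℤ; +_; _*_)
  open import Data.Bool using (true; false; if_then_else_)
  open import Data.Fin using (Fin; zero; suc; punchIn; toℕ)
  open import Relation.Binary.Core using (_Preserves_⟶_)
  open import Relation.Binary.PropositionalEquality
  open BooleanCube
  open Sums using (sumℤ-cong)

  det-cong : ∀ n {M M′ : Matrix n} → (∀ i j → M i j ≡ M′ i j) → det n M ≡ det n M′
  det-cong zero _ = refl
  det-cong (suc n) M≡M′ = sumℤ-cong (suc n) λ j →
    cong₂ (λ a b → signℤ (toℕ j) * (a * b)) (M≡M′ zero j) (det-cong n λ i k → M≡M′ (suc i) (punchIn j k))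

  det-DegreeBelow : ∀ {m} n (M : Fin n → Fin n → Signing m → ℤ) →
    (∀ i j → DegreeBelow 2 (M i j)) → DegreeBelow (suc n) (λ s → det n (λ i j → M i j s))
  det-DegreeBelow zero M D = const-DegreeBelow 0 (+ 1)
  det-DegreeBelow (suc n) M D = sum-DegreeBelow (suc (suc n)) (suc n) _ λ j →
    *-DegreeBelow 1 (suc n) (const-DegreeBelow 0 (signℤ (toℕ j)))
      (*-DegreeBelow 2 n (D zero j) (det-DegreeBelow n _ (λ i k → D (suc i) (punchIn j k))))

  module _ {n m : ℕ} (G : SimpleGraph n m) where

    det-signedAdj-Preserves : (λ s → det n (signedAdj G s)) Preserves _≗_ ⟶ _≡_
    det-signedAdj-Preserves s≗t = det-cong n λ i j → sumℤ-cong m λ e →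
      cong (λ b → if joins G e i j then signVal b else + 0) (s≗t e)

    det-signedAdj-DegreeBelow : DegreeBelow (suc n) (λ s → det n (signedAdj G s))
    det-signedAdj-DegreeBelow = det-DegreeBelow n (λ i j s → signedAdj G s i j) λ i j →
      sum-DegreeBelow 2 m _ λ e → entry-DegreeBelow (joins G e i j) e
      where
      entry-DegreeBelow : ∀ b e → DegreeBelow 2 (λ s → if b then signVal (s e) else + 0)
      entry-DegreeBelow true e = coordinate-DegreeBelow e
      entry-DegreeBelow false e = Vanishes⇒DegreeBelow 2 (λ _ → refl)

module Sign where

  open import Data.Nat using (ℕ; zero; suc)
  open import Data.Integer using (ℤ; -_; _*_; -1ℤ; 1ℤ)
  import Data.Integer.Properties as ℤ
  open import Data.Integer.Tactic.RingSolver using (solve-∀)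
  open import Data.Bool using (Bool; true; false; if_then_else_; not)
  open import Data.Fin using (Fin; zero; suc; punchIn; toℕ; _≟_)
  open import Data.Fin.Permutation as Perm using (Permutation′; _⟨$⟩ʳ_; _⟨$⟩ˡ_; inverseˡ; inverseʳ)
  open import Data.Empty using (⊥-elim)
  open import Function using (_∘_; Injective)
  open import Relation.Nullary using (yes; no)
  open import Relation.Binary.PropositionalEquality
  import Algebra.Properties.CommutativeMonoid.Sum as MonoidSum

  private
    variable
      n : ℕ

  ∏ : (Fin n → ℤ) → ℤ
  ∏ {zero} f = 1ℤ
  ∏ {suc n} f = f zero * ∏ (f ∘ suc)

  ∏-cong : {f g : Fin n → ℤ} → f ≗ g → ∏ f ≡ ∏ g
  ∏-cong {zero} f≗g = refl
  ∏-cong {suc n} f≗g = cong₂ _*_ (f≗g zero) (∏-cong (f≗g ∘ suc))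

  ∏-ones : (f : Fin n → ℤ) → (∀ i → f i ≡ 1ℤ) → ∏ f ≡ 1ℤ
  ∏-ones {zero} f f≗1 = refl
  ∏-ones {suc n} f f≗1 = cong₂ _*_ (f≗1 zero) (∏-ones (f ∘ suc) (f≗1 ∘ suc))

  IsSign : ℤ → Set
  IsSign x = x * x ≡ 1ℤ

  ∏-IsSign : (f : Fin n → ℤ) → (∀ i → IsSign (f i)) → IsSign (∏ f)
  ∏-IsSign {zero} f _ = refl
  ∏-IsSign {suc n} f f± = trans (square-* (f zero) (∏ (f ∘ suc))) (cong₂ _*_ (f± zero) (∏-IsSign (f ∘ suc) (f± ∘ suc)))
    where
    square-* : ∀ a b → a * b * (a * b) ≡ a * a * (b * b)
    square-* = solve-∀

  *-cancelʳ-IsSign : ∀ {u v s} → IsSign s → u * s ≡ v * s → u ≡ v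
  *-cancelʳ-IsSign {u} {v} {s} s² us≡vs = begin
    u                ≡⟨ ℤ.*-identityʳ u ⟨
    u * 1ℤ           ≡⟨ cong (u *_) s² ⟨
    u * (s * s)      ≡⟨ ℤ.*-assoc u s s ⟨
    u * s * s        ≡⟨ cong (_* s) us≡vs ⟩
    v * s * s        ≡⟨ ℤ.*-assoc v s s ⟩
    v * (s * s)      ≡⟨ cong (v *_) s² ⟩
    v * 1ℤ           ≡⟨ ℤ.*-identityʳ v ⟩
    v                ∎
    where open ≡-Reasoning

  _<ᵇ_ : Fin n → Fin n → Bool
  zero  <ᵇ zero  = false
  zero  <ᵇ suc _ = true
  suc _ <ᵇ zero  = false
  suc x <ᵇ suc y = x <ᵇ y

  <ᵇ-irrefl : (x : Fin n) → (x <ᵇ x) ≡ false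
  <ᵇ-irrefl zero = refl
  <ᵇ-irrefl (suc x) = <ᵇ-irrefl x

  <ᵇ-asym : (x y : Fin n) → (x <ᵇ y) ≡ true → (y <ᵇ x) ≡ false
  <ᵇ-asym zero (suc y) _ = refl
  <ᵇ-asym (suc x) (suc y) x<y = <ᵇ-asym x y x<y

  <ᵇ-connex : (x y : Fin n) → x ≢ y → (x <ᵇ y) ≡ not (y <ᵇ x)
  <ᵇ-connex zero zero x≢y = ⊥-elim (x≢y refl)
  <ᵇ-connex zero (suc y) _ = refl
  <ᵇ-connex (suc x) zero _ = refl
  <ᵇ-connex (suc x) (suc y) x≢y = <ᵇ-connex x y (x≢y ∘ cong suc)

  punchIn-<ᵇ : (j : Fin (suc n)) (x y : Fin n) → (punchIn j x <ᵇ punchIn j y) ≡ (x <ᵇ y)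
  punchIn-<ᵇ zero x y = refl
  punchIn-<ᵇ (suc j) zero zero = refl
  punchIn-<ᵇ (suc j) zero (suc y) = refl
  punchIn-<ᵇ (suc j) (suc x) zero = refl
  punchIn-<ᵇ (suc j) (suc x) (suc y) = punchIn-<ᵇ j x y

  orientation : Fin n → Fin n → ℤ
  orientation x y = if y <ᵇ x then -1ℤ else 1ℤ

  orientation-IsSign : (x y : Fin n) → IsSign (orientation x y)
  orientation-IsSign x y with y <ᵇ x
  ... | true = refl
  ... | false = refl

  orientation-anti : (x y : Fin n) → x ≢ y → orientation y x ≡ - orientation x y
  orientation-anti x y x≢y rewrite <ᵇ-connex x y x≢y with y <ᵇ x
  ... | true = refl
  ... | false = refl

  orientation-< : (x y : Fin n) → (x <ᵇ y) ≡ true → orientation x y ≡ 1ℤ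
  orientation-< x y x<y rewrite <ᵇ-asym x y x<y = refl

  orientation-punchIn : (j : Fin (suc n)) (x y : Fin n) → orientation (punchIn j x) (punchIn j y) ≡ orientation x y
  orientation-punchIn j x y rewrite punchIn-<ᵇ j y x = refl

  ∏∏ : (Fin n → Fin n → ℤ) → ℤ
  ∏∏ K = ∏ λ i → ∏ λ j → K i j

  ∏< : (Fin n → Fin n → ℤ) → ℤ
  ∏< K = ∏∏ λ i j → if i <ᵇ j then K i j else 1ℤ

  ∏<-cong : {K L : Fin n → Fin n → ℤ} → (∀ i j → (i <ᵇ j) ≡ true → K i j ≡ L i j) → ∏< K ≡ ∏< L
  ∏<-cong {K = K} {L} K≡L = ∏-cong λ i → ∏-cong λ j → on-pairs i j
    where
    on-pairs : ∀ i j → (if i <ᵇ j then K i j else 1ℤ) ≡ (if i <ᵇ j then L i j else 1ℤ)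
    on-pairs i j with i <ᵇ j in i<j
    ... | true = K≡L i j i<j
    ... | false = refl

  ∏<-IsSign : (K : Fin n → Fin n → ℤ) → (∀ i j → IsSign (K i j)) → IsSign (∏< K)
  ∏<-IsSign K K± = ∏-IsSign _ λ i → ∏-IsSign _ λ j → on-pairs i j
    where
    on-pairs : ∀ i j → IsSign (if i <ᵇ j then K i j else 1ℤ)
    on-pairs i j with i <ᵇ j
    ... | true = K± i j
    ... | false = refl

  sign : (Fin n → Fin n) → ℤ
  sign f = ∏< λ i j → orientation (f i) (f j)

  sign-cong : {f g : Fin n → Fin n} → f ≗ g → sign f ≡ sign g
  sign-cong f≗g = ∏<-cong λ i j _ → cong₂ orientation (f≗g i) (f≗g j)

  sign-IsSign : (f : Fin n → Fin n) → IsSign (sign f)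
  sign-IsSign f = ∏<-IsSign _ λ i j → orientation-IsSign (f i) (f j)

  sign-id : {f : Fin n → Fin n} → f ≗ (λ i → i) → sign f ≡ 1ℤ
  sign-id {n} f≗id = trans (sign-cong f≗id) (∏-ones {n} _ λ i → ∏-ones {n} _ λ j → identity-pair i j)
    where
    identity-pair : ∀ i j → (if i <ᵇ j then orientation i j else 1ℤ) ≡ 1ℤ
    identity-pair i j with i <ᵇ j in i<j
    ... | true = orientation-< i j i<j
    ... | false = refl

  ∏-* : (f g : Fin n → ℤ) → ∏ (λ i → f i * g i) ≡ ∏ f * ∏ g
  ∏-* {zero} f g = refl
  ∏-* {suc n} f g = trans (cong (f zero * g zero *_) (∏-* (f ∘ suc) (g ∘ suc)))
    (interchange (f zero) (g zero) (∏ (f ∘ suc)) (∏ (g ∘ suc)))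
    where
    interchange : ∀ a b c d → a * b * (c * d) ≡ a * c * (b * d)
    interchange = solve-∀

  ∏-permute : (f : Fin n → ℤ) (π : Permutation′ n) → ∏ f ≡ ∏ (f ∘ (π ⟨$⟩ʳ_))
  ∏-permute f π = trans (∏≡sum f) (trans (∏.∑-permute f π) (sym (∏≡sum (f ∘ (π ⟨$⟩ʳ_)))))
    where
    module ∏ = MonoidSum ℤ.*-1-commutativeMonoid
    ∏≡sum : ∀ {n} (f : Fin n → ℤ) → ∏ f ≡ ∏.sum f
    ∏≡sum {zero} f = refl
    ∏≡sum {suc n} f = cong (f zero *_) (∏≡sum (f ∘ suc))

  ∏∏-pairs : (K : Fin n → Fin n → ℤ) → ∏∏ K ≡ ∏< (λ i j → K i j * K j i) * ∏ (λ i → K i i)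
  ∏∏-pairs {zero} K = refl
  ∏∏-pairs {suc n} K = begin
    (K₀₀ * ∏ row₀) * ∏ (λ i → K (suc i) zero * ∏ (K′ i))
      ≡⟨ cong ((K₀₀ * ∏ row₀) *_) (∏-* col₀ (∏ ∘ K′)) ⟩
    (K₀₀ * ∏ row₀) * (∏ col₀ * ∏∏ K′)
      ≡⟨ cong (λ x → (K₀₀ * ∏ row₀) * (∏ col₀ * x)) (∏∏-pairs K′) ⟩
    (K₀₀ * ∏ row₀) * (∏ col₀ * (∏< K′-pairs * ∏ (λ i → K′ i i)))
      ≡⟨ regroup K₀₀ (∏ row₀) (∏ col₀) (∏< K′-pairs) (∏ (λ i → K′ i i)) ⟩
    ((∏ row₀ * ∏ col₀) * ∏< K′-pairs) * (K₀₀ * ∏ (λ i → K′ i i))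
      ≡⟨ cong (λ x → (x * ∏< K′-pairs) * (K₀₀ * ∏ (λ i → K′ i i))) (∏-* row₀ col₀) ⟨
    (∏ (λ j → row₀ j * col₀ j) * ∏< K′-pairs) * (K₀₀ * ∏ (λ i → K′ i i))
      ≡⟨ cong₂ (λ x y → (x * y) * (K₀₀ * ∏ (λ i → K′ i i)))
               (ℤ.*-identityˡ (∏ (λ j → row₀ j * col₀ j)))
               (∏-cong λ i → ℤ.*-identityˡ (∏ λ j → if i <ᵇ j then K′-pairs i j else 1ℤ)) ⟨
    ∏< (λ i j → K i j * K j i) * ∏ (λ i → K i i) ∎
    where
    open ≡-Reasoning
    K₀₀ = K zero zero
    row₀ col₀ : Fin n → ℤ
    row₀ j = K zero (suc j)
    col₀ i = K (suc i) zero
    K′ : Fin n → Fin n → ℤ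
    K′ i j = K (suc i) (suc j)
    K′-pairs : Fin n → Fin n → ℤ
    K′-pairs i j = K′ i j * K′ j i
    regroup : ∀ a b c d e → (a * b) * (c * (d * e)) ≡ ((b * c) * d) * (a * e)
    regroup = solve-∀

  -- Each unordered pair {x , y} contributes its symmetric weight once, through whichever of
  -- P x y and P y x holds.
  ∏∏-tournament : (P : Fin n → Fin n → Bool) (G : Fin n → Fin n → ℤ) →
    (∀ x → P x x ≡ false) → (∀ x y → x ≢ y → P x y ≡ not (P y x)) → (∀ x y → G x y ≡ G y x) →
    ∏∏ (λ x y → if P x y then G x y else 1ℤ) ≡ ∏< G
  ∏∏-tournament P G irrefl connex G-sym = begin
    ∏∏ (λ x y → if P x y then G x y else 1ℤ)
      ≡⟨ ∏∏-pairs (λ x y → if P x y then G x y else 1ℤ) ⟩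
    ∏< (λ i j → (if P i j then G i j else 1ℤ) * (if P j i then G j i else 1ℤ)) * ∏ (λ i → if P i i then G i i else 1ℤ)
      ≡⟨ cong₂ _*_ (∏<-cong one-of-pair) (∏-ones _ diagonal) ⟩
    ∏< G * 1ℤ
      ≡⟨ ℤ.*-identityʳ (∏< G) ⟩
    ∏< G ∎
    where
    open ≡-Reasoning
    one-of-pair : ∀ i j → (i <ᵇ j) ≡ true →
      (if P i j then G i j else 1ℤ) * (if P j i then G j i else 1ℤ) ≡ G i j
    one-of-pair i j i<j with i ≟ j
    ... | yes refl = ⊥-elim (false≢true (trans (sym (<ᵇ-irrefl i)) i<j))
      where
      false≢true : false ≢ true
      false≢true ()
    ... | no i≢j rewrite connex i j i≢j with P j i
    ...   | true = trans (ℤ.*-identityˡ _) (G-sym j i)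
    ...   | false = ℤ.*-identityʳ _
    diagonal : ∀ i → (if P i i then G i i else 1ℤ) ≡ 1ℤ
    diagonal i rewrite irrefl i = refl

  -- Relabelling the positions by τ turns the inversion product of σ into that of σ ∘ τ,
  -- up to the inversions of τ itself.
  sign-∘ : (σ : Fin n → Fin n) (τ : Permutation′ n) → Injective _≡_ _≡_ σ →
    sign (σ ∘ (τ ⟨$⟩ʳ_)) ≡ sign σ * sign (τ ⟨$⟩ʳ_)
  sign-∘ {n} σ τ σ-injective = begin
    sign (σ ∘ t)
      ≡⟨ ∏<-cong (λ i j _ → sym (cancel (t i) (t j))) ⟩
    ∏< (λ i j → F (t i) (t j) * orientation (t i) (t j))
      ≡⟨ ∏-cong (λ i → trans (∏-cong λ j → if-* (i <ᵇ j) (F (t i) (t j)) (orientation (t i) (t j))) (∏-* {n} _ _)) ⟩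
    ∏ (λ i → ∏ (λ j → if i <ᵇ j then F (t i) (t j) else 1ℤ) * ∏ (λ j → if i <ᵇ j then orientation (t i) (t j) else 1ℤ))
      ≡⟨ ∏-* {n} _ _ ⟩
    ∏< (λ i j → F (t i) (t j)) * sign t
      ≡⟨ cong (_* sign t) relabel ⟩
    sign σ * sign t ∎
    where
    open ≡-Reasoning
    t = τ ⟨$⟩ʳ_
    u = τ ⟨$⟩ˡ_
    F : Fin n → Fin n → ℤ
    F x y = orientation (σ x) (σ y) * orientation x y
    cancel : ∀ x y → F x y * orientation x y ≡ orientation (σ x) (σ y)
    cancel x y = trans (ℤ.*-assoc (orientation (σ x) (σ y)) (orientation x y) (orientation x y))
      (trans (cong (orientation (σ x) (σ y) *_) (orientation-IsSign x y)) (ℤ.*-identityʳ (orientation (σ x) (σ y))))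
    if-* : ∀ b x y → (if b then x * y else 1ℤ) ≡ (if b then x else 1ℤ) * (if b then y else 1ℤ)
    if-* true x y = refl
    if-* false x y = refl
    F-sym : ∀ x y → F x y ≡ F y x
    F-sym x y with x ≟ y
    ... | yes refl = refl
    ... | no x≢y = trans (sym (neg-*-neg (orientation (σ x) (σ y)) (orientation x y)))
      (cong₂ _*_ (sym (orientation-anti (σ x) (σ y) (x≢y ∘ σ-injective))) (sym (orientation-anti x y x≢y)))
      where
      neg-*-neg : ∀ a b → (- a) * (- b) ≡ a * b
      neg-*-neg = solve-∀
    u-injective : ∀ {x y} → u x ≡ u y → x ≡ y
    u-injective {x} {y} ux≡uy = trans (sym (inverseʳ τ)) (trans (cong t ux≡uy) (inverseʳ τ))
    P : Fin n → Fin n → Bool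
    P x y = u x <ᵇ u y
    relabel : ∏< (λ i j → F (t i) (t j)) ≡ sign σ
    relabel = begin
      ∏< (λ i j → F (t i) (t j))
        ≡⟨ ∏-cong (λ i → ∏-cong λ j → cong₂ (λ a b → if a <ᵇ b then F (t i) (t j) else 1ℤ) (inverseˡ τ) (inverseˡ τ)) ⟨
      ∏ (λ i → ∏ (λ j → if P (t i) (t j) then F (t i) (t j) else 1ℤ))
        ≡⟨ ∏-cong (λ i → ∏-permute (λ j → if P (t i) j then F (t i) j else 1ℤ) τ) ⟨
      ∏ (λ i → ∏ (λ j → if P (t i) j then F (t i) j else 1ℤ))
        ≡⟨ ∏-permute (λ i → ∏ (λ j → if P i j then F i j else 1ℤ)) τ ⟨
      ∏∏ (λ i j → if P i j then F i j else 1ℤ)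
        ≡⟨ ∏∏-tournament P F (λ x → <ᵇ-irrefl (u x)) (λ x y x≢y → <ᵇ-connex (u x) (u y) (x≢y ∘ u-injective)) F-sym ⟩
      ∏< F
        ≡⟨ ∏<-cong (λ i j i<j → trans (cong (orientation (σ i) (σ j) *_) (orientation-< i j i<j)) (ℤ.*-identityʳ _)) ⟩
      sign σ ∎

  orientation-row : (j : Fin (suc n)) → ∏ (λ y → orientation j (punchIn j y)) ≡ signℤ (toℕ j)
  orientation-row {n} zero = ∏-ones {n} _ λ _ → refl
  orientation-row {suc n} (suc j) = trans (cong (-1ℤ *_) (orientation-row j)) (ℤ.-1*i≡-i (signℤ (toℕ j)))

  sign-insert₀ : (j : Fin (suc n)) (π : Permutation′ n) →
    sign (Perm.insert zero j π ⟨$⟩ʳ_) ≡ signℤ (toℕ j) * sign (π ⟨$⟩ʳ_)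
  sign-insert₀ j π = begin
    (1ℤ * ∏ (λ y → orientation j (π̂ y))) * ∏ (λ x → 1ℤ * ∏ (λ y → if x <ᵇ y then orientation (π̂ x) (π̂ y) else 1ℤ))
      ≡⟨ cong₂ _*_ (trans (ℤ.*-identityˡ _) (sym (∏-permute (λ y → orientation j (punchIn j y)) π)))
                   (∏-cong λ x → trans (ℤ.*-identityˡ _) (∏-cong λ y →
                     cong (if x <ᵇ y then_else 1ℤ) (orientation-punchIn j (π ⟨$⟩ʳ x) (π ⟨$⟩ʳ y)))) ⟩
    ∏ (λ y → orientation j (punchIn j y)) * sign (π ⟨$⟩ʳ_)
      ≡⟨ cong (_* sign (π ⟨$⟩ʳ_)) (orientation-row j) ⟩
    signℤ (toℕ j) * sign (π ⟨$⟩ʳ_) ∎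
    where
    open ≡-Reasoning
    π̂ : Fin _ → Fin (suc _)
    π̂ y = punchIn j (π ⟨$⟩ʳ y)

module Leibniz where

  open import Data.Nat using (ℕ; zero; suc)
  open import Data.Integer using (ℤ; _*_; 0ℤ; _≤_; _<_)
  open import Data.Integer.Tactic.RingSolver using (solve-∀)
  open import Data.Fin using (Fin; zero; suc; punchIn; toℕ)
  open import Data.Fin.Permutation as Perm using (Permutation′; _⟨$⟩ʳ_)
  open import Data.Product using (_×_; _,_)
  open import Data.Unit using (⊤; tt)
  open import Relation.Binary.PropositionalEquality
  open Sums
  open Sign

  private
    variable
      n : ℕ

  -- A permutation of Fin (suc n) is its value at zero together with a permutation of Fin n.
  LehmerCode : ℕ → Set
  LehmerCode zero = ⊤
  LehmerCode (suc n) = Fin (suc n) × LehmerCode n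

  decode : LehmerCode n → Permutation′ n
  decode {zero} _ = Perm.id
  decode {suc n} (j , c) = Perm.insert zero j (decode c)

  encode : Permutation′ n → LehmerCode n
  encode {zero} _ = tt
  encode {suc n} π = π ⟨$⟩ʳ zero , encode (Perm.remove zero π)

  decode-encode : (π : Permutation′ n) (i : Fin n) → decode (encode π) ⟨$⟩ʳ i ≡ π ⟨$⟩ʳ i
  decode-encode {suc n} π zero = refl
  decode-encode {suc n} π (suc i) =
    trans (cong (punchIn (π ⟨$⟩ʳ zero)) (decode-encode (Perm.remove zero π) i)) (Perm.insert-remove zero π (suc i))

  ∑ᴸ : (LehmerCode n → ℤ) → ℤ
  ∑ᴸ {zero} F = F tt
  ∑ᴸ {suc n} F = sumℤ (suc n) λ j → ∑ᴸ λ c → F (j , c)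

  ∑ᴸ-cong : {F G : LehmerCode n → ℤ} → F ≗ G → ∑ᴸ F ≡ ∑ᴸ G
  ∑ᴸ-cong {zero} F≗G = F≗G tt
  ∑ᴸ-cong {suc n} F≗G = sumℤ-cong (suc n) λ j → ∑ᴸ-cong λ c → F≗G (j , c)

  *-distribˡ-∑ᴸ : ∀ a (F : LehmerCode n → ℤ) → a * ∑ᴸ F ≡ ∑ᴸ (λ c → a * F c)
  *-distribˡ-∑ᴸ {zero} a F = refl
  *-distribˡ-∑ᴸ {suc n} a F = trans (*-distribˡ-sumℤ (suc n) a λ j → ∑ᴸ λ c → F (j , c))
    (sumℤ-cong (suc n) λ j → *-distribˡ-∑ᴸ a (λ c → F (j , c)))

  ∑ᴸ-nonneg : (F : LehmerCode n → ℤ) → (∀ c → 0ℤ ≤ F c) → 0ℤ ≤ ∑ᴸ F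
  ∑ᴸ-nonneg {zero} F F≥0 = F≥0 tt
  ∑ᴸ-nonneg {suc n} F F≥0 = sumℤ-nonneg (suc n) _ λ j → ∑ᴸ-nonneg (λ c → F (j , c)) (λ c → F≥0 (j , c))

  ∑ᴸ-positive : (F : LehmerCode n → ℤ) → (∀ c → 0ℤ ≤ F c) → ∀ c → 0ℤ < F c → 0ℤ < ∑ᴸ F
  ∑ᴸ-positive {zero} F F≥0 tt F>0 = F>0
  ∑ᴸ-positive {suc n} F F≥0 (j , c) F>0 =
    sumℤ-positive (suc n) _ (λ j → ∑ᴸ-nonneg (λ c → F (j , c)) (λ c → F≥0 (j , c))) j
      (∑ᴸ-positive (λ c → F (j , c)) (λ c → F≥0 (j , c)) c F>0)

  leibniz : ∀ n (M : Matrix n) → det n M ≡ ∑ᴸ λ c → sign (decode c ⟨$⟩ʳ_) * ∏ (λ i → M i (decode c ⟨$⟩ʳ i))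
  leibniz zero M = refl
  leibniz (suc n) M = sumℤ-cong (suc n) expand-row
    where
    open ≡-Reasoning
    expand-row : ∀ j → signℤ (toℕ j) * (M zero j * det n (λ i k → M (suc i) (punchIn j k))) ≡
      ∑ᴸ (λ c → sign (decode (j , c) ⟨$⟩ʳ_) * (M zero j * ∏ (λ i → M (suc i) (punchIn j (decode c ⟨$⟩ʳ i)))))
    expand-row j = begin
      signℤ (toℕ j) * (M zero j * det n _)
        ≡⟨ cong (λ x → signℤ (toℕ j) * (M zero j * x)) (leibniz n _) ⟩
      signℤ (toℕ j) * (M zero j * ∑ᴸ λ c → sign (decode c ⟨$⟩ʳ_) * minor c)
        ≡⟨ cong (signℤ (toℕ j) *_) (*-distribˡ-∑ᴸ {n} (M zero j) _) ⟩
      signℤ (toℕ j) * ∑ᴸ (λ c → M zero j * (sign (decode c ⟨$⟩ʳ_) * minor c))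
        ≡⟨ *-distribˡ-∑ᴸ {n} (signℤ (toℕ j)) _ ⟩
      ∑ᴸ (λ c → signℤ (toℕ j) * (M zero j * (sign (decode c ⟨$⟩ʳ_) * minor c)))
        ≡⟨ ∑ᴸ-cong {n} (λ c → trans (regroup (signℤ (toℕ j)) (M zero j) (sign (decode c ⟨$⟩ʳ_)) (minor c))
                                     (cong (_* (M zero j * minor c)) (sym (sign-insert₀ j (decode c))))) ⟩
      ∑ᴸ (λ c → sign (decode (j , c) ⟨$⟩ʳ_) * (M zero j * minor c)) ∎
      where
      minor : LehmerCode n → ℤ
      minor c = ∏ λ i → M (suc i) (punchIn j (decode c ⟨$⟩ʳ i))
      regroup : ∀ a b s p → a * (b * (s * p)) ≡ (a * s) * (b * p)
      regroup = solve-∀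

module BooleanEquality where

  open import Data.Nat using (ℕ)
  open import Data.Bool using (Bool; true; false; _xor_)
  import Data.Bool.Properties as Bool
  open import Data.Fin using (Fin; _≟_)
  open import Data.Empty using (⊥-elim)
  open import Function using (_∘_)
  open import Relation.Nullary using (yes; no)
  open import Relation.Binary.PropositionalEquality

  private
    variable
      n : ℕ

  true≢false : true ≢ false
  true≢false ()

  -- ⌊_⌋ is the one of Defs, so that joins and incident unfold to these tests.
  _≡ᵇ_ : Fin n → Fin n → Bool
  x ≡ᵇ y = ⌊ x ≟ y ⌋

  ≡⇒≡ᵇ : {x y : Fin n} → x ≡ y → (x ≡ᵇ y) ≡ true
  ≡⇒≡ᵇ {x = x} refl with x ≟ x
  ... | yes _ = refl
  ... | no x≢x = ⊥-elim (x≢x refl)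

  ≢⇒≡ᵇ : {x y : Fin n} → x ≢ y → (x ≡ᵇ y) ≡ false
  ≢⇒≡ᵇ {x = x} {y} x≢y with x ≟ y
  ... | yes x≡y = ⊥-elim (x≢y x≡y)
  ... | no _ = refl

  ≡ᵇ⇒≡ : {x y : Fin n} → (x ≡ᵇ y) ≡ true → x ≡ y
  ≡ᵇ⇒≡ {x = x} {y} eq with x ≟ y
  ... | yes x≡y = x≡y

  ≡ᵇ-sym : (x y : Fin n) → (x ≡ᵇ y) ≡ (y ≡ᵇ x)
  ≡ᵇ-sym x y with x ≟ y
  ... | yes refl = sym (≡⇒≡ᵇ refl)
  ... | no x≢y = sym (≢⇒≡ᵇ (x≢y ∘ sym))

  xor-cancelˡ : ∀ p q → p xor (p xor q) ≡ q
  xor-cancelˡ p q = trans (sym (Bool.xor-assoc p p q)) (cong (_xor q) (Bool.xor-same p))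

  xor-interchange : ∀ p q r s → (p xor q) xor (r xor s) ≡ (p xor r) xor (q xor s)
  xor-interchange p q r s = begin
    (p xor q) xor (r xor s)   ≡⟨ Bool.xor-assoc p q (r xor s) ⟩
    p xor (q xor (r xor s))   ≡⟨ cong (p xor_) (sym (Bool.xor-assoc q r s)) ⟩
    p xor ((q xor r) xor s)   ≡⟨ cong (λ t → p xor (t xor s)) (Bool.xor-comm q r) ⟩
    p xor ((r xor q) xor s)   ≡⟨ cong (p xor_) (Bool.xor-assoc r q s) ⟩
    p xor (r xor (q xor s))   ≡⟨ sym (Bool.xor-assoc p r (q xor s)) ⟩
    (p xor r) xor (q xor s)   ∎
    where open ≡-Reasoning

module PermutationFacts where

  open import Data.Nat using (ℕ)
  open import Data.Fin using (Fin; _≟_)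
  open import Data.Fin.Permutation using (Permutation′; _⟨$⟩ʳ_; _⟨$⟩ˡ_; inverseˡ; inverseʳ; transpose)
  import Data.Fin.Permutation.Components as PC
  open import Data.Empty using (⊥-elim)
  open import Function using (_∘_)
  open import Relation.Nullary using (Dec; yes; no)
  open import Relation.Binary.PropositionalEquality
  open BooleanEquality

  private
    variable
      n : ℕ

  module _ (ρ : Permutation′ n) where

    ⟨$⟩ʳ-injective : ∀ {x y} → ρ ⟨$⟩ʳ x ≡ ρ ⟨$⟩ʳ y → x ≡ y
    ⟨$⟩ʳ-injective {x} {y} eq = trans (sym (inverseˡ ρ)) (trans (cong (ρ ⟨$⟩ˡ_) eq) (inverseˡ ρ))

    ⟨$⟩ˡ-≡ : ∀ {y z} → ρ ⟨$⟩ʳ y ≡ z → ρ ⟨$⟩ˡ z ≡ y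
    ⟨$⟩ˡ-≡ refl = inverseˡ ρ

    ⟨$⟩ʳ-≡ : ∀ {y z} → ρ ⟨$⟩ˡ z ≡ y → ρ ⟨$⟩ʳ y ≡ z
    ⟨$⟩ʳ-≡ refl = inverseʳ ρ

    ≡ᵇ-move : ∀ u v → ((ρ ⟨$⟩ʳ u) ≡ᵇ v) ≡ (u ≡ᵇ (ρ ⟨$⟩ˡ v))
    ≡ᵇ-move u v with u ≟ ρ ⟨$⟩ˡ v
    ... | yes u≡ρ⁻¹v = ≡⇒≡ᵇ (⟨$⟩ʳ-≡ (sym u≡ρ⁻¹v))
    ... | no u≢ρ⁻¹v = ≢⇒≡ᵇ (u≢ρ⁻¹v ∘ sym ∘ ⟨$⟩ˡ-≡)

  transpose-i : (i j : Fin n) → PC.transpose i j i ≡ j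
  transpose-i i j with i ≟ i
  ... | yes _ = refl
  ... | no i≢i = ⊥-elim (i≢i refl)

  transpose-j : (i j : Fin n) → PC.transpose i j j ≡ i
  transpose-j i j with j ≟ i
  ... | yes j≡i = j≡i
  ... | no _ with j ≟ j
  ...   | yes _ = refl
  ...   | no j≢j = ⊥-elim (j≢j refl)

  transpose-other : {i j k : Fin n} → k ≢ i → k ≢ j → PC.transpose i j k ≡ k
  transpose-other {i = i} {j} {k} k≢i k≢j with k ≟ i
  ... | yes k≡i = ⊥-elim (k≢i k≡i)
  ... | no _ with k ≟ j
  ...   | yes k≡j = ⊥-elim (k≢j k≡j)
  ...   | no _ = refl

  transpose-comm : (i j k : Fin n) → PC.transpose i j k ≡ PC.transpose j i k
  transpose-comm i j k = by-cases (k ≟ i) (k ≟ j)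
    where
    by-cases : Dec (k ≡ i) → Dec (k ≡ j) → PC.transpose i j k ≡ PC.transpose j i k
    by-cases (yes refl) _ = trans (transpose-i k j) (sym (transpose-j j k))
    by-cases (no _) (yes refl) = trans (transpose-j i k) (sym (transpose-i k i))
    by-cases (no k≢i) (no k≢j) = trans (transpose-other k≢i k≢j) (sym (transpose-other k≢j k≢i))

  transpose-injective : (i j : Fin n) → ∀ {x y} → PC.transpose i j x ≡ PC.transpose i j y → x ≡ y
  transpose-injective i j = ⟨$⟩ʳ-injective (transpose i j)

module CycleShape where

  open import Data.Nat using (ℕ)
  open import Data.Integer using (_*_; 1ℤ)
  import Data.Integer.Properties as ℤ
  open import Data.Integer.Tactic.RingSolver using (solve-∀)
  open import Data.Bool using (Bool; true; false; _∧_; _xor_)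
  import Data.Bool.Properties as Bool
  open import Data.Fin using (Fin; _≟_)
  open import Data.Fin.Permutation using (Permutation′; _⟨$⟩ʳ_; _⟨$⟩ˡ_; inverseʳ; _∘ₚ_; transpose)
  import Data.Fin.Permutation.Components as PC
  open import Data.List using (List; []; _∷_; allFin)
  open import Data.List.Membership.Propositional using (_∈_)
  open import Data.List.Membership.Propositional.Properties using (∈-allFin)
  open import Data.List.Relation.Unary.Any using (here; there)
  open import Data.Product using (_×_; _,_)
  open import Data.Sum using (_⊎_; inj₁; inj₂)
  open import Data.Empty using (⊥-elim)
  open import Function using (_∘_)
  open import Relation.Nullary using (Dec; yes; no)
  open import Relation.Binary.PropositionalEquality
  open Sign
  open BooleanEquality
  open PermutationFacts

  private
    variable
      n : ℕ

  -- The cycles of ρ traverse an edge {y , z} once if it lies on a cycle of length ≥ 3 and twice if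
  -- y and z form a 2-cycle; oddEdge ρ y z records the first case.
  oddEdge : Permutation′ n → Fin n → Fin n → Bool
  oddEdge ρ y z = ((ρ ⟨$⟩ʳ y) ≡ᵇ z) xor ((ρ ⟨$⟩ʳ z) ≡ᵇ y)

  fixed : Permutation′ n → Fin n → Bool
  fixed ρ y = (ρ ⟨$⟩ʳ y) ≡ᵇ y

  oddEdge-sym : (ρ : Permutation′ n) (y z : Fin n) → oddEdge ρ y z ≡ oddEdge ρ z y
  oddEdge-sym ρ y z = Bool.xor-comm ((ρ ⟨$⟩ʳ y) ≡ᵇ z) ((ρ ⟨$⟩ʳ z) ≡ᵇ y)

  oddEdge-2-cycle : (ρ : Permutation′ n) {y : Fin n} → ρ ⟨$⟩ʳ (ρ ⟨$⟩ʳ y) ≡ y → ∀ z → oddEdge ρ y z ≡ false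
  oddEdge-2-cycle ρ {y} ρ²y≡y z = begin
    ((ρ ⟨$⟩ʳ y) ≡ᵇ z) xor ((ρ ⟨$⟩ʳ z) ≡ᵇ y)   ≡⟨ cong (((ρ ⟨$⟩ʳ y) ≡ᵇ z) xor_) (≡ᵇ-move ρ z y) ⟩
    ((ρ ⟨$⟩ʳ y) ≡ᵇ z) xor (z ≡ᵇ (ρ ⟨$⟩ˡ y))   ≡⟨ cong (λ w → ((ρ ⟨$⟩ʳ y) ≡ᵇ z) xor (z ≡ᵇ w)) (⟨$⟩ˡ-≡ ρ ρ²y≡y) ⟩
    ((ρ ⟨$⟩ʳ y) ≡ᵇ z) xor (z ≡ᵇ (ρ ⟨$⟩ʳ y))   ≡⟨ cong (((ρ ⟨$⟩ʳ y) ≡ᵇ z) xor_) (≡ᵇ-sym z (ρ ⟨$⟩ʳ y)) ⟩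
    ((ρ ⟨$⟩ʳ y) ≡ᵇ z) xor ((ρ ⟨$⟩ʳ y) ≡ᵇ z)   ≡⟨ Bool.xor-same ((ρ ⟨$⟩ʳ y) ≡ᵇ z) ⟩
    false                                     ∎
    where open ≡-Reasoning

  -- Two permutations with the same cycles of length ≥ 3 (up to orientation) and the same fixed points;
  -- their 2-cycles may be matched differently.
  record SameShape (π π′ : Permutation′ n) : Set where
    field
      oddEdges : ∀ y z → oddEdge π y z ≡ oddEdge π′ y z
      fixedPoints : ∀ y → fixed π y ≡ fixed π′ y
  open SameShape

  SameShape-trans : {π π′ π″ : Permutation′ n} → SameShape π π′ → SameShape π′ π″ → SameShape π π″
  SameShape-trans S T = record
    { oddEdges = λ y z → trans (oddEdges S y z) (oddEdges T y z)
    ; fixedPoints = λ y → trans (fixedPoints S y) (fixedPoints T y)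
    }

  -- The indicator of {u , x}, provided u ≢ x.
  either : Fin n → Fin n → Fin n → Bool
  either u x y = (y ≡ᵇ u) xor (y ≡ᵇ x)

  either-left : {u x : Fin n} → u ≢ x → either u x u ≡ true
  either-left {u = u} u≢x = cong₂ _xor_ (≡⇒≡ᵇ {x = u} refl) (≢⇒≡ᵇ u≢x)

  either-right : {u x : Fin n} → u ≢ x → either u x x ≡ true
  either-right {x = x} u≢x = cong₂ _xor_ (≢⇒≡ᵇ (u≢x ∘ sym)) (≡⇒≡ᵇ {x = x} refl)

  either-neither : {u x y : Fin n} → y ≢ u → y ≢ x → either u x y ≡ false
  either-neither y≢u y≢x = cong₂ _xor_ (≢⇒≡ᵇ y≢u) (≢⇒≡ᵇ y≢x)

  -- Cutting x out of the path b → x → a flips the parity of the edges {b , x}, {x , a} and {b , a}.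
  flipped : Fin n → Fin n → Fin n → Fin n → Fin n → Bool
  flipped a b x y z = (either b x y ∧ either a x z) xor (either b x z ∧ either a x y)

  flipped-comm : (a b x y z : Fin n) → flipped a b x y z ≡ flipped b a x y z
  flipped-comm a b x y z = trans (Bool.xor-comm (either b x y ∧ either a x z) _)
    (cong₂ _xor_ (Bool.∧-comm (either b x z) (either a x y)) (Bool.∧-comm (either b x y) (either a x z)))

  -- ρ with x cut out of its cycle: ρ⁻¹ x ↦ ρ x and x ↦ x (_∘ₚ_ composes left to right).
  bypass : Fin n → Permutation′ n → Permutation′ n
  bypass x ρ = transpose (ρ ⟨$⟩ˡ x) x ∘ₚ ρ

  module Bypass (ρ : Permutation′ n) (x : Fin n) (x-moves : fixed ρ x ≡ false) where

    a b : Fin n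
    a = ρ ⟨$⟩ʳ x
    b = ρ ⟨$⟩ˡ x

    a≢x : a ≢ x
    a≢x a≡x = true≢false (trans (sym (≡⇒≡ᵇ a≡x)) x-moves)

    b≢x : b ≢ x
    b≢x b≡x = a≢x (⟨$⟩ʳ-≡ ρ b≡x)

    ρb≡x : ρ ⟨$⟩ʳ b ≡ x
    ρb≡x = inverseʳ ρ

    at-x : bypass x ρ ⟨$⟩ʳ x ≡ x
    at-x = trans (cong (ρ ⟨$⟩ʳ_) (transpose-j b x)) ρb≡x

    at-b : bypass x ρ ⟨$⟩ʳ b ≡ a
    at-b = cong (ρ ⟨$⟩ʳ_) (transpose-i b x)

    elsewhere : ∀ {y} → y ≢ x → y ≢ b → bypass x ρ ⟨$⟩ʳ y ≡ ρ ⟨$⟩ʳ y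
    elsewhere y≢x y≢b = cong (ρ ⟨$⟩ʳ_) (transpose-other y≢b y≢x)

    ≡ᵇ-bypass : ∀ y z → ((bypass x ρ ⟨$⟩ʳ y) ≡ᵇ z) ≡ ((ρ ⟨$⟩ʳ y) ≡ᵇ z) xor (either b x y ∧ either a x z)
    ≡ᵇ-bypass y z = by-cases (y ≟ x) (y ≟ b)
      where
      open ≡-Reasoning
      by-cases : Dec (y ≡ x) → Dec (y ≡ b) →
        ((bypass x ρ ⟨$⟩ʳ y) ≡ᵇ z) ≡ ((ρ ⟨$⟩ʳ y) ≡ᵇ z) xor (either b x y ∧ either a x z)
      by-cases (yes refl) _ = begin
        (bypass x ρ ⟨$⟩ʳ x) ≡ᵇ z                       ≡⟨ cong (_≡ᵇ z) at-x ⟩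
        x ≡ᵇ z                                         ≡⟨ xor-cancelˡ (a ≡ᵇ z) (x ≡ᵇ z) ⟨
        (a ≡ᵇ z) xor ((a ≡ᵇ z) xor (x ≡ᵇ z))
          ≡⟨ cong₂ (λ p q → (a ≡ᵇ z) xor (p xor q)) (≡ᵇ-sym a z) (≡ᵇ-sym x z) ⟩
        (a ≡ᵇ z) xor either a x z
          ≡⟨ cong (λ p → (a ≡ᵇ z) xor (p ∧ either a x z)) (either-right b≢x) ⟨
        (a ≡ᵇ z) xor (either b x x ∧ either a x z)     ∎
      by-cases (no y≢x) (yes refl) = begin
        (bypass x ρ ⟨$⟩ʳ b) ≡ᵇ z                       ≡⟨ cong (_≡ᵇ z) at-b ⟩
        a ≡ᵇ z                                         ≡⟨ xor-cancelˡ (x ≡ᵇ z) (a ≡ᵇ z) ⟨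
        (x ≡ᵇ z) xor ((x ≡ᵇ z) xor (a ≡ᵇ z))           ≡⟨ cong ((x ≡ᵇ z) xor_) (Bool.xor-comm (x ≡ᵇ z) (a ≡ᵇ z)) ⟩
        (x ≡ᵇ z) xor ((a ≡ᵇ z) xor (x ≡ᵇ z))           ≡⟨ cong₂ (λ p q → (p ≡ᵇ z) xor q) (sym ρb≡x)
                                                            (cong₂ _xor_ (≡ᵇ-sym a z) (≡ᵇ-sym x z)) ⟩
        ((ρ ⟨$⟩ʳ b) ≡ᵇ z) xor either a x z
          ≡⟨ cong (λ p → ((ρ ⟨$⟩ʳ b) ≡ᵇ z) xor (p ∧ either a x z)) (either-left b≢x) ⟨
        ((ρ ⟨$⟩ʳ b) ≡ᵇ z) xor (either b x b ∧ either a x z) ∎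
      by-cases (no y≢x) (no y≢b) = begin
        (bypass x ρ ⟨$⟩ʳ y) ≡ᵇ z                       ≡⟨ cong (_≡ᵇ z) (elsewhere y≢x y≢b) ⟩
        (ρ ⟨$⟩ʳ y) ≡ᵇ z                                ≡⟨ Bool.xor-identityʳ _ ⟨
        ((ρ ⟨$⟩ʳ y) ≡ᵇ z) xor false
          ≡⟨ cong (λ p → ((ρ ⟨$⟩ʳ y) ≡ᵇ z) xor (p ∧ either a x z)) (either-neither y≢b y≢x) ⟨
        ((ρ ⟨$⟩ʳ y) ≡ᵇ z) xor (either b x y ∧ either a x z) ∎

    oddEdge-bypass : ∀ y z → oddEdge (bypass x ρ) y z ≡ oddEdge ρ y z xor flipped a b x y z
    oddEdge-bypass y z = trans (cong₂ _xor_ (≡ᵇ-bypass y z) (≡ᵇ-bypass z y))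
      (xor-interchange ((ρ ⟨$⟩ʳ y) ≡ᵇ z) _ ((ρ ⟨$⟩ʳ z) ≡ᵇ y) _)

    fixed-bypass : ∀ y → fixed (bypass x ρ) y ≡ fixed ρ y xor (either b x y ∧ either a x y)
    fixed-bypass y = ≡ᵇ-bypass y y

    bypass-fixes : ∀ y → fixed ρ y ≡ true → fixed (bypass x ρ) y ≡ true
    bypass-fixes y y-fixed = trans (cong (_≡ᵇ y) (elsewhere y≢x y≢b)) y-fixed
      where
      y≢x : y ≢ x
      y≢x refl = true≢false (trans (sym y-fixed) x-moves)
      y≢b : y ≢ b
      y≢b refl = b≢x (trans (sym (≡ᵇ⇒≡ y-fixed)) ρb≡x)

    moved-by-bypass : ∀ y → fixed (bypass x ρ) y ≡ false → fixed ρ y ≡ false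
    moved-by-bypass y y-moves with fixed ρ y in y-fixed
    ... | true = ⊥-elim (true≢false (trans (sym (bypass-fixes y y-fixed)) y-moves))
    ... | false = refl

    bypass-moved-≢ : ∀ y → fixed (bypass x ρ) y ≡ false → y ≢ x
    bypass-moved-≢ y y-moves refl = true≢false (trans (sym (≡⇒≡ᵇ at-x)) y-moves)

    bypass-on-left : ∀ y → bypass x ρ ⟨$⟩ʳ y ≡ PC.transpose x a (ρ ⟨$⟩ʳ y)
    bypass-on-left y = by-cases (y ≟ x) (y ≟ b)
      where
      by-cases : Dec (y ≡ x) → Dec (y ≡ b) → bypass x ρ ⟨$⟩ʳ y ≡ PC.transpose x a (ρ ⟨$⟩ʳ y)
      by-cases (yes refl) _ = trans at-x (sym (transpose-j x a))
      by-cases (no _) (yes refl) = trans at-b (sym (trans (cong (PC.transpose x a) ρb≡x) (transpose-i x a)))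
      by-cases (no y≢x) (no y≢b) = trans (elsewhere y≢x y≢b)
        (sym (transpose-other (y≢b ∘ sym ∘ ⟨$⟩ˡ-≡ ρ) (y≢x ∘ ⟨$⟩ʳ-injective ρ)))

    sign-bypassʳ : sign (bypass x ρ ⟨$⟩ʳ_) ≡ sign (ρ ⟨$⟩ʳ_) * sign (PC.transpose b x)
    sign-bypassʳ = sign-∘ (ρ ⟨$⟩ʳ_) (transpose b x) (⟨$⟩ʳ-injective ρ)

    sign-bypassˡ : sign (bypass x ρ ⟨$⟩ʳ_) ≡ sign (PC.transpose x a) * sign (ρ ⟨$⟩ʳ_)
    sign-bypassˡ = trans (sign-cong bypass-on-left) (sign-∘ (PC.transpose x a) ρ (transpose-injective x a))

  conjugate : Fin n → Fin n → Permutation′ n → Permutation′ n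
  conjugate p q ρ = transpose p q ∘ₚ (ρ ∘ₚ transpose p q)

  ≡ᵇ-transpose : (p q u v : Fin n) → (PC.transpose p q u ≡ᵇ v) ≡ (u ≡ᵇ PC.transpose p q v)
  ≡ᵇ-transpose p q u v = trans (≡ᵇ-move (transpose p q) u v) (cong (u ≡ᵇ_) (transpose-comm q p v))

  module Conjugate (p q : Fin n) (ρ : Permutation′ n) where

    private
      t = PC.transpose p q

    sign-conjugate : sign (conjugate p q ρ ⟨$⟩ʳ_) ≡ sign (ρ ⟨$⟩ʳ_)
    sign-conjugate = begin
      sign (t ∘ (ρ ⟨$⟩ʳ_) ∘ t)
        ≡⟨ sign-∘ (t ∘ (ρ ⟨$⟩ʳ_)) (transpose p q) (⟨$⟩ʳ-injective ρ ∘ transpose-injective p q) ⟩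
      sign (t ∘ (ρ ⟨$⟩ʳ_)) * sign t            ≡⟨ cong (_* sign t) (sign-∘ t ρ (transpose-injective p q)) ⟩
      sign t * sign (ρ ⟨$⟩ʳ_) * sign t         ≡⟨ sandwich (sign t) (sign (ρ ⟨$⟩ʳ_)) ⟩
      sign t * sign t * sign (ρ ⟨$⟩ʳ_)         ≡⟨ cong (_* sign (ρ ⟨$⟩ʳ_)) (sign-IsSign t) ⟩
      1ℤ * sign (ρ ⟨$⟩ʳ_)                      ≡⟨ ℤ.*-identityˡ _ ⟩
      sign (ρ ⟨$⟩ʳ_)                           ∎
      where
      open ≡-Reasoning
      sandwich : ∀ s r → s * r * s ≡ s * s * r
      sandwich = solve-∀

    oddEdge-conjugate : ∀ y z → oddEdge (conjugate p q ρ) y z ≡ oddEdge ρ (t y) (t z)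
    oddEdge-conjugate y z = cong₂ _xor_ (≡ᵇ-transpose p q (ρ ⟨$⟩ʳ t y) z) (≡ᵇ-transpose p q (ρ ⟨$⟩ʳ t z) y)

    fixed-conjugate : ∀ y → fixed (conjugate p q ρ) y ≡ fixed ρ (t y)
    fixed-conjugate y = ≡ᵇ-transpose p q (ρ ⟨$⟩ʳ t y) y

    conjugate-SameShape : (∀ z → oddEdge ρ p z ≡ false) → (∀ z → oddEdge ρ q z ≡ false) →
      fixed ρ p ≡ fixed ρ q → SameShape ρ (conjugate p q ρ)
    conjugate-SameShape p-isolated q-isolated p~q = record
      { oddEdges = λ y z → sym (trans (oddEdge-conjugate y z) (swap-both y z))
      ; fixedPoints = λ y → sym (trans (fixed-conjugate y) (fixed-swap (y ≟ p) (y ≟ q)))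
      }
      where
      isolated-or-fixed : ∀ y → (∀ z → oddEdge ρ y z ≡ false) × (∀ z → oddEdge ρ (t y) z ≡ false) ⊎ t y ≡ y
      isolated-or-fixed y = by-cases (y ≟ p) (y ≟ q)
        where
        by-cases : Dec (y ≡ p) → Dec (y ≡ q) →
          (∀ z → oddEdge ρ y z ≡ false) × (∀ z → oddEdge ρ (t y) z ≡ false) ⊎ t y ≡ y
        by-cases (yes refl) _ =
          inj₁ (p-isolated , λ z → trans (cong (λ w → oddEdge ρ w z) (transpose-i p q)) (q-isolated z))
        by-cases (no _) (yes refl) =
          inj₁ (q-isolated , λ z → trans (cong (λ w → oddEdge ρ w z) (transpose-j p q)) (p-isolated z))
        by-cases (no y≢p) (no y≢q) = inj₂ (transpose-other y≢p y≢q)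
      swap-both : ∀ y z → oddEdge ρ (t y) (t z) ≡ oddEdge ρ y z
      swap-both y z with isolated-or-fixed y | isolated-or-fixed z
      ... | inj₁ (y-iso , ty-iso) | _ = trans (ty-iso (t z)) (sym (y-iso z))
      ... | inj₂ ty≡y | inj₁ (z-iso , tz-iso) =
        trans (oddEdge-sym ρ (t y) (t z)) (trans (tz-iso (t y)) (sym (trans (oddEdge-sym ρ y z) (z-iso y))))
      ... | inj₂ ty≡y | inj₂ tz≡z = cong₂ (oddEdge ρ) ty≡y tz≡z
      fixed-swap : ∀ {y} → Dec (y ≡ p) → Dec (y ≡ q) → fixed ρ (t y) ≡ fixed ρ y
      fixed-swap (yes refl) _ = trans (cong (fixed ρ) (transpose-i p q)) (sym p~q)
      fixed-swap (no _) (yes refl) = trans (cong (fixed ρ) (transpose-j p q)) p~q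
      fixed-swap (no y≢p) (no y≢q) = cong (fixed ρ) (transpose-other y≢p y≢q)

  Aligned : Permutation′ n → Permutation′ n → Fin n → Set
  Aligned π π′ x = (π′ ⟨$⟩ʳ x ≡ π ⟨$⟩ʳ x × π′ ⟨$⟩ˡ x ≡ π ⟨$⟩ˡ x) ⊎ (π′ ⟨$⟩ʳ x ≡ π ⟨$⟩ˡ x × π′ ⟨$⟩ˡ x ≡ π ⟨$⟩ʳ x)

  module _ {π π′ : Permutation′ n} (S : SameShape π π′) {x : Fin n} (x-moves : fixed π x ≡ false) where

    private
      a b : Fin n
      a = π ⟨$⟩ʳ x
      b = π ⟨$⟩ˡ x
      module B = Bypass π x x-moves
      module B′ = Bypass π′ x (trans (sym (fixedPoints S x)) x-moves)

    long-cycle-Aligned : a ≢ b → Aligned π π′ x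
    long-cycle-Aligned a≢b = by-cases (π′ ⟨$⟩ʳ x ≟ a)
      where
      xa-odd : oddEdge π′ x a ≡ true
      xa-odd = trans (sym (oddEdges S x a))
        (cong₂ _xor_ (≡⇒≡ᵇ {x = a} refl) (≢⇒≡ᵇ (a≢b ∘ sym ∘ ⟨$⟩ˡ-≡ π)))
      xb-odd : oddEdge π′ x b ≡ true
      xb-odd = trans (sym (oddEdges S x b)) (cong₂ _xor_ (≢⇒≡ᵇ a≢b) (≡⇒≡ᵇ B.ρb≡x))
      by-cases : Dec (π′ ⟨$⟩ʳ x ≡ a) → Aligned π π′ x
      by-cases (yes π′x≡a) = inj₁ (π′x≡a , ⟨$⟩ˡ-≡ π′ (≡ᵇ⇒≡ π′b≡x))
        where
        π′b≡x : ((π′ ⟨$⟩ʳ b) ≡ᵇ x) ≡ true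
        π′b≡x = trans (sym (cong (_xor ((π′ ⟨$⟩ʳ b) ≡ᵇ x)) (trans (cong (_≡ᵇ b) π′x≡a) (≢⇒≡ᵇ a≢b)))) xb-odd
      by-cases (no π′x≢a) = inj₂ (≡ᵇ⇒≡ π′x≡b , π′⁻¹x≡a)
        where
        π′a≡x : ((π′ ⟨$⟩ʳ a) ≡ᵇ x) ≡ true
        π′a≡x = trans (sym (cong (_xor ((π′ ⟨$⟩ʳ a) ≡ᵇ x)) (≢⇒≡ᵇ π′x≢a))) xa-odd
        π′⁻¹x≡a : π′ ⟨$⟩ˡ x ≡ a
        π′⁻¹x≡a = ⟨$⟩ˡ-≡ π′ (≡ᵇ⇒≡ π′a≡x)
        π′x≡b : ((π′ ⟨$⟩ʳ x) ≡ᵇ b) ≡ true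
        π′x≡b = trans (sym (Bool.xor-identityʳ _))
          (trans (cong (((π′ ⟨$⟩ʳ x) ≡ᵇ b) xor_) (sym (≢⇒≡ᵇ λ π′b≡x → a≢b (trans (sym π′⁻¹x≡a) (⟨$⟩ˡ-≡ π′ π′b≡x))))) xb-odd)

    two-cycle-involutive : a ≡ b → π′ ⟨$⟩ʳ (π′ ⟨$⟩ʳ x) ≡ x
    two-cycle-involutive a≡b =
      ≡ᵇ⇒≡ (not-injective (trans (sym (cong (_xor ((π′ ⟨$⟩ʳ (π′ ⟨$⟩ʳ x)) ≡ᵇ x)) (≡⇒≡ᵇ {x = π′ ⟨$⟩ʳ x} refl))) x-isolated′))
      where
      not-injective : ∀ {p} → true xor p ≡ false → p ≡ true
      not-injective {true} _ = refl
      x-isolated′ : oddEdge π′ x (π′ ⟨$⟩ʳ x) ≡ false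
      x-isolated′ = trans (sym (oddEdges S x _)) (oddEdge-2-cycle π (trans (cong (π ⟨$⟩ʳ_) a≡b) B.ρb≡x) _)

    same-two-cycle-Aligned : a ≡ b → π′ ⟨$⟩ʳ x ≡ a → Aligned π π′ x
    same-two-cycle-Aligned a≡b π′x≡a = inj₁ (π′x≡a , trans (⟨$⟩ˡ-≡ π′ (two-cycle-involutive a≡b)) (trans π′x≡a a≡b))

    -- π has the 2-cycle (x a) and π′ the 2-cycle (x w); exchanging a and w in π′ repairs this.
    realign : a ≡ b → π′ ⟨$⟩ʳ x ≢ a →
      SameShape π (conjugate a (π′ ⟨$⟩ʳ x) π′) × Aligned π (conjugate a (π′ ⟨$⟩ʳ x) π′) x
    realign a≡b w≢a = SameShape-trans S (C.conjugate-SameShape a-isolated w-isolated (trans a-moves′ (sym w-moves′))) ,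
                      inj₁ (π″x≡a , trans (⟨$⟩ˡ-≡ π″ π″a≡x) a≡b)
      where
      w = π′ ⟨$⟩ʳ x
      module C = Conjugate a w π′
      π″ = conjugate a w π′
      π′w≡x : π′ ⟨$⟩ʳ w ≡ x
      π′w≡x = two-cycle-involutive a≡b
      πa≡x : π ⟨$⟩ʳ a ≡ x
      πa≡x = trans (cong (π ⟨$⟩ʳ_) a≡b) B.ρb≡x
      x≢a : x ≢ a
      x≢a = B.a≢x ∘ sym
      x≢w : x ≢ w
      x≢w = B′.a≢x ∘ sym
      a-isolated : ∀ z → oddEdge π′ a z ≡ false
      a-isolated z = trans (sym (oddEdges S a z)) (oddEdge-2-cycle π (cong (π ⟨$⟩ʳ_) πa≡x) z)
      w-isolated : ∀ z → oddEdge π′ w z ≡ false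
      w-isolated = oddEdge-2-cycle π′ (cong (π′ ⟨$⟩ʳ_) π′w≡x)
      a-moves′ : fixed π′ a ≡ false
      a-moves′ = trans (sym (fixedPoints S a)) (trans (cong (_≡ᵇ a) πa≡x) (≢⇒≡ᵇ x≢a))
      w-moves′ : fixed π′ w ≡ false
      w-moves′ = trans (cong (_≡ᵇ w) π′w≡x) (≢⇒≡ᵇ x≢w)
      π″x≡a : π″ ⟨$⟩ʳ x ≡ a
      π″x≡a = trans (cong (λ u → PC.transpose a w (π′ ⟨$⟩ʳ u)) (transpose-other x≢a x≢w)) (transpose-j a w)
      π″a≡x : π″ ⟨$⟩ʳ a ≡ x
      π″a≡x = trans (cong (λ u → PC.transpose a w (π′ ⟨$⟩ʳ u)) (transpose-i a w))
                    (trans (cong (PC.transpose a w) π′w≡x) (transpose-other x≢a x≢w))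

    bypass-SameShape : Aligned π π′ x → SameShape (bypass x π) (bypass x π′)
    bypass-SameShape aligned = record
      { oddEdges = λ y z → trans (B.oddEdge-bypass y z)
          (trans (cong₂ _xor_ (oddEdges S y z) (flipped-aligned aligned y z)) (sym (B′.oddEdge-bypass y z)))
      ; fixedPoints = λ y → trans (B.fixed-bypass y)
          (trans (cong₂ _xor_ (fixedPoints S y) (ends-aligned aligned y)) (sym (B′.fixed-bypass y)))
      }
      where
      flipped-aligned : Aligned π π′ x → ∀ y z → flipped a b x y z ≡ flipped B′.a B′.b x y z
      flipped-aligned (inj₁ (π′x≡a , π′⁻¹x≡b)) y z = sym (cong₂ (λ u v → flipped u v x y z) π′x≡a π′⁻¹x≡b)
      flipped-aligned (inj₂ (π′x≡b , π′⁻¹x≡a)) y z =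
        trans (flipped-comm a b x y z) (sym (cong₂ (λ u v → flipped u v x y z) π′x≡b π′⁻¹x≡a))
      ends-aligned : Aligned π π′ x → ∀ y → (either b x y ∧ either a x y) ≡ (either B′.b x y ∧ either B′.a x y)
      ends-aligned (inj₁ (π′x≡a , π′⁻¹x≡b)) y = sym (cong₂ (λ u v → either v x y ∧ either u x y) π′x≡a π′⁻¹x≡b)
      ends-aligned (inj₂ (π′x≡b , π′⁻¹x≡a)) y =
        trans (Bool.∧-comm (either b x y) _) (sym (cong₂ (λ u v → either v x y ∧ either u x y) π′x≡b π′⁻¹x≡a))

    -- Bypassing x multiplies both signs by the sign of the transposition of b and x.
    sign-from-bypass : Aligned π π′ x → sign (bypass x π ⟨$⟩ʳ_) ≡ sign (bypass x π′ ⟨$⟩ʳ_) →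
      sign (π ⟨$⟩ʳ_) ≡ sign (π′ ⟨$⟩ʳ_)
    sign-from-bypass aligned bypassed = *-cancelʳ-IsSign (sign-IsSign (PC.transpose b x)) (begin
      sign (π ⟨$⟩ʳ_) * τ          ≡⟨ B.sign-bypassʳ ⟨
      sign (bypass x π ⟨$⟩ʳ_)     ≡⟨ bypassed ⟩
      sign (bypass x π′ ⟨$⟩ʳ_)    ≡⟨ by-orientation aligned ⟩
      sign (π′ ⟨$⟩ʳ_) * τ         ∎)
      where
      open ≡-Reasoning
      τ = sign (PC.transpose b x)
      by-orientation : Aligned π π′ x → sign (bypass x π′ ⟨$⟩ʳ_) ≡ sign (π′ ⟨$⟩ʳ_) * τ
      by-orientation (inj₁ (_ , π′⁻¹x≡b)) = trans B′.sign-bypassʳ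
        (cong (λ u → sign (π′ ⟨$⟩ʳ_) * sign (PC.transpose u x)) π′⁻¹x≡b)
      by-orientation (inj₂ (π′x≡b , _)) = trans B′.sign-bypassˡ (trans
        (cong (λ u → sign (PC.transpose x u) * sign (π′ ⟨$⟩ʳ_)) π′x≡b)
        (trans (cong (_* sign (π′ ⟨$⟩ʳ_)) (sign-cong (transpose-comm x b))) (ℤ.*-comm τ _)))

  ∈-∷-≢ : ∀ {y x : Fin n} {xs} → y ∈ x ∷ xs → y ≢ x → y ∈ xs
  ∈-∷-≢ (here y≡x) y≢x = ⊥-elim (y≢x y≡x)
  ∈-∷-≢ (there y∈xs) _ = y∈xs

  -- xs contains the points moved by π; bypassing the first of them in both permutations shortens it.
  sign-SameShape-on : (xs : List (Fin n)) {π π′ : Permutation′ n} →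
    (∀ y → fixed π y ≡ false → y ∈ xs) → SameShape π π′ → sign (π ⟨$⟩ʳ_) ≡ sign (π′ ⟨$⟩ʳ_)
  sign-SameShape-on [] {π} {π′} moves S = trans (sign-id (≡ᵇ⇒≡ ∘ fixes)) (sym (sign-id (≡ᵇ⇒≡ ∘ fixes′)))
    where
    fixes : ∀ y → fixed π y ≡ true
    fixes y with fixed π y in y-fixed
    ... | true = refl
    ... | false with () ← moves y y-fixed
    fixes′ : ∀ y → fixed π′ y ≡ true
    fixes′ y = trans (sym (fixedPoints S y)) (fixes y)
  sign-SameShape-on (x ∷ xs) {π} {π′} moves S with fixed π x in x-fixed
  ... | true = sign-SameShape-on xs moves-xs S
    where
    moves-xs : ∀ y → fixed π y ≡ false → y ∈ xs
    moves-xs y y-moves = ∈-∷-≢ (moves y y-moves) λ { refl → true≢false (trans (sym x-fixed) y-moves) }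
  ... | false = by-neighbours (π ⟨$⟩ʳ x ≟ π ⟨$⟩ˡ x) (π′ ⟨$⟩ʳ x ≟ π ⟨$⟩ʳ x)
    where
    module B = Bypass π x x-fixed
    moves-bypass : ∀ y → fixed (bypass x π) y ≡ false → y ∈ xs
    moves-bypass y y-moves = ∈-∷-≢ (moves y (B.moved-by-bypass y y-moves)) (B.bypass-moved-≢ y y-moves)
    via-bypass : ∀ {π″} → SameShape π π″ → Aligned π π″ x → sign (π ⟨$⟩ʳ_) ≡ sign (π″ ⟨$⟩ʳ_)
    via-bypass S″ aligned = sign-from-bypass S″ x-fixed aligned
      (sign-SameShape-on xs moves-bypass (bypass-SameShape S″ x-fixed aligned))
    by-neighbours : Dec (π ⟨$⟩ʳ x ≡ π ⟨$⟩ˡ x) → Dec (π′ ⟨$⟩ʳ x ≡ π ⟨$⟩ʳ x) → sign (π ⟨$⟩ʳ_) ≡ sign (π′ ⟨$⟩ʳ_)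
    by-neighbours (no a≢b) _ = via-bypass S (long-cycle-Aligned S x-fixed a≢b)
    by-neighbours (yes a≡b) (yes w≡a) = via-bypass S (same-two-cycle-Aligned S x-fixed a≡b w≡a)
    by-neighbours (yes a≡b) (no w≢a) =
      let S″ , aligned = realign S x-fixed a≡b w≢a
      in trans (via-bypass S″ aligned) (Conjugate.sign-conjugate (π ⟨$⟩ʳ x) (π′ ⟨$⟩ʳ x) π′)

  sign-SameShape : {π π′ : Permutation′ n} → SameShape π π′ → sign (π ⟨$⟩ʳ_) ≡ sign (π′ ⟨$⟩ʳ_)
  sign-SameShape {n} = sign-SameShape-on (allFin n) (λ y _ → ∈-allFin y)

module BooleanFolds where

  open import Data.Nat using (ℕ; zero; suc)
  open import Data.Bool using (Bool; true; false; _∧_; _∨_; _xor_)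
  import Data.Bool.Properties as Bool
  open import Data.Empty using (⊥-elim)
  open import Data.Fin using (Fin; zero; suc)
  import Data.Fin.Properties as Fin
  open import Data.Product using (Σ; _,_)
  open import Function using (_∘_)
  open import Relation.Binary.PropositionalEquality

  private
    variable
      k : ℕ

  anyᵇ allᵇ parity : (Fin k → Bool) → Bool
  anyᵇ {zero} P = false
  anyᵇ {suc k} P = P zero ∨ anyᵇ (P ∘ suc)
  allᵇ {zero} P = true
  allᵇ {suc k} P = P zero ∧ allᵇ (P ∘ suc)
  parity {zero} P = false
  parity {suc k} P = P zero xor parity (P ∘ suc)

  allᵇ-intro : (P : Fin k → Bool) → (∀ i → P i ≡ true) → allᵇ P ≡ true
  allᵇ-intro {zero} P _ = refl
  allᵇ-intro {suc k} P P≗true rewrite P≗true zero = allᵇ-intro (P ∘ suc) (P≗true ∘ suc)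

  allᵇ-elim : (P : Fin k → Bool) → allᵇ P ≡ true → ∀ i → P i ≡ true
  allᵇ-elim {suc k} P all with P zero in P₀
  ... | true = λ { zero → P₀ ; (suc i) → allᵇ-elim (P ∘ suc) all i }

  allᵇ-counterexample : (P : Fin k → Bool) → allᵇ P ≡ false → Σ (Fin k) λ i → P i ≡ false
  allᵇ-counterexample {suc k} P none with P zero in P₀
  ... | false = zero , P₀
  ... | true with i , Pi ← allᵇ-counterexample (P ∘ suc) none = suc i , Pi

  anyᵇ-intro : (P : Fin k → Bool) (i : Fin k) → P i ≡ true → anyᵇ P ≡ true
  anyᵇ-intro P zero Pi rewrite Pi = refl
  anyᵇ-intro P (suc i) Pi with P zero
  ... | true = refl
  ... | false = anyᵇ-intro (P ∘ suc) i Pi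

  anyᵇ-witness : (P : Fin k → Bool) → anyᵇ P ≡ true → Σ (Fin k) λ i → P i ≡ true
  anyᵇ-witness {suc k} P some with P zero in P₀
  ... | true = zero , P₀
  ... | false with i , Pi ← anyᵇ-witness (P ∘ suc) some = suc i , Pi

  anyᵇ-none : (P : Fin k → Bool) → anyᵇ P ≡ false → ∀ i → P i ≡ false
  anyᵇ-none P none i with P i in Pi
  ... | false = refl
  ... | true = trans (sym (anyᵇ-intro P i Pi)) none

  parity-cong : {P Q : Fin k → Bool} → P ≗ Q → parity P ≡ parity Q
  parity-cong {zero} P≗Q = refl
  parity-cong {suc k} P≗Q = cong₂ _xor_ (P≗Q zero) (parity-cong (P≗Q ∘ suc))

  parity-none : (P : Fin k → Bool) → (∀ i → P i ≡ false) → parity P ≡ false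
  parity-none {zero} P _ = refl
  parity-none {suc k} P P≗false rewrite P≗false zero = parity-none (P ∘ suc) (P≗false ∘ suc)

  parity-single : (P : Fin k → Bool) (a : Fin k) → (∀ i → i ≢ a → P i ≡ false) → parity P ≡ P a
  parity-single {suc k} P zero rest rewrite parity-none (P ∘ suc) (λ i → rest (suc i) λ ()) =
    Bool.xor-identityʳ (P zero)
  parity-single {suc k} P (suc a) rest rewrite rest zero (λ ()) =
    parity-single (P ∘ suc) a (λ i i≢a → rest (suc i) (i≢a ∘ Fin.suc-injective))

  parity-pair : (P : Fin k → Bool) {a b : Fin k} → a ≢ b → (∀ i → i ≢ a → i ≢ b → P i ≡ false) → parity P ≡ P a xor P b
  parity-pair {suc k} P {zero} {zero} a≢b _ = ⊥-elim (a≢b refl)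
  parity-pair {suc k} P {zero} {suc b} _ rest =
    cong (P zero xor_) (parity-single (P ∘ suc) b λ i i≢b → rest (suc i) (λ ()) (i≢b ∘ Fin.suc-injective))
  parity-pair {suc k} P {suc a} {zero} _ rest =
    trans (cong (P zero xor_) (parity-single (P ∘ suc) a λ i i≢a → rest (suc i) (i≢a ∘ Fin.suc-injective) (λ ())))
          (Bool.xor-comm (P zero) (P (suc a)))
  parity-pair {suc k} P {suc a} {suc b} a≢b rest rewrite rest zero (λ ()) (λ ()) =
    parity-pair (P ∘ suc) (a≢b ∘ cong suc)
      (λ i i≢a i≢b → rest (suc i) (i≢a ∘ Fin.suc-injective) (i≢b ∘ Fin.suc-injective))

module Characters where

  open import Data.Nat as ℕ using (ℕ; zero; suc; _^_)
  import Data.Nat.Properties as ℕ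
  open import Data.Integer using (ℤ; +_; -_; _+_; _*_; 0ℤ; 1ℤ; -1ℤ)
  import Data.Integer.Properties as ℤ
  open import Data.Integer.Tactic.RingSolver using (solve-∀)
  open import Data.Bool using (Bool; true; false; if_then_else_; not; _xor_)
  open import Data.Fin using (Fin; zero; suc)
  import Data.Fin.Properties as Fin
  open import Data.Vec.Functional using ([]; _∷_)
  open import Data.Product using (_,_)
  open import Function using (_∘_)
  open import Relation.Binary.PropositionalEquality
  open BooleanCube using (Vanishes; _↾_)
  open Sums
  open Sign using (∏; ∏-cong; ∏-ones; ∏-*)
  open Leibniz using (LehmerCode; ∑ᴸ)

  private
    variable
      m n : ℕ

  ∑cube : (Signing m → ℤ) → ℤ
  ∑cube {zero} f = f []
  ∑cube {suc m} f = ∑cube (f ↾ true) + ∑cube (f ↾ false)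

  ∑cube-cong : {f g : Signing m → ℤ} → f ≗ g → ∑cube f ≡ ∑cube g
  ∑cube-cong {zero} f≗g = f≗g []
  ∑cube-cong {suc m} f≗g = cong₂ _+_ (∑cube-cong (f≗g ∘ (true ∷_))) (∑cube-cong (f≗g ∘ (false ∷_)))

  ∑cube-Vanishes : {f : Signing m → ℤ} → Vanishes f → ∑cube f ≡ 0ℤ
  ∑cube-Vanishes {zero} f≗0 = f≗0 []
  ∑cube-Vanishes {suc m} f≗0 = cong₂ _+_ (∑cube-Vanishes (f≗0 ∘ (true ∷_))) (∑cube-Vanishes (f≗0 ∘ (false ∷_)))

  ∑cube-*ˡ : ∀ a (f : Signing m → ℤ) → ∑cube (λ s → a * f s) ≡ a * ∑cube f
  ∑cube-*ˡ {zero} a f = refl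
  ∑cube-*ˡ {suc m} a f = trans (cong₂ _+_ (∑cube-*ˡ a (f ↾ true)) (∑cube-*ˡ a (f ↾ false)))
    (sym (ℤ.*-distribˡ-+ a (∑cube (f ↾ true)) (∑cube (f ↾ false))))

  ∑cube-+ : (f g : Signing m → ℤ) → ∑cube (λ s → f s + g s) ≡ ∑cube f + ∑cube g
  ∑cube-+ {zero} f g = refl
  ∑cube-+ {suc m} f g = trans (cong₂ _+_ (∑cube-+ (f ↾ true) (g ↾ true)) (∑cube-+ (f ↾ false) (g ↾ false)))
    (interchange (∑cube (f ↾ true)) (∑cube (g ↾ true)) (∑cube (f ↾ false)) (∑cube (g ↾ false)))
    where
    interchange : ∀ a b c d → a + b + (c + d) ≡ a + c + (b + d)
    interchange = solve-∀

  ∑cube-sumℤ : ∀ k (F : Fin k → Signing m → ℤ) → ∑cube (λ s → sumℤ k (λ j → F j s)) ≡ sumℤ k (λ j → ∑cube (F j))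
  ∑cube-sumℤ {m} zero F = ∑cube-Vanishes {m} (λ _ → refl)
  ∑cube-sumℤ (suc k) F = trans (∑cube-+ (F zero) (λ s → sumℤ k (λ j → F (suc j) s)))
    (cong (λ x → ∑cube (F zero) + x) (∑cube-sumℤ k (F ∘ suc)))

  ∑cube-∑ᴸ : (F : LehmerCode n → Signing m → ℤ) → ∑cube (λ s → ∑ᴸ (λ c → F c s)) ≡ ∑ᴸ (λ c → ∑cube (F c))
  ∑cube-∑ᴸ {zero} F = refl
  ∑cube-∑ᴸ {suc n} F = trans (∑cube-sumℤ (suc n) (λ j s → ∑ᴸ (λ c → F (j , c) s)))
    (sumℤ-cong (suc n) λ j → ∑cube-∑ᴸ (λ c → F (j , c)))

  χ : (Fin m → Bool) → Signing m → ℤ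
  χ T s = ∏ λ e → if T e then signVal (s e) else 1ℤ

  χ-xor : (P Q : Fin m → Bool) (s : Signing m) → χ P s * χ Q s ≡ χ (λ e → P e xor Q e) s
  χ-xor {m} P Q s = trans (sym (∏-* {m} _ _)) (∏-cong factor)
    where
    factor : ∀ e → (if P e then signVal (s e) else 1ℤ) * (if Q e then signVal (s e) else 1ℤ)
                   ≡ (if P e xor Q e then signVal (s e) else 1ℤ)
    factor e with P e | Q e | s e
    ... | true  | true  | true  = refl
    ... | true  | true  | false = refl
    ... | true  | false | _     = ℤ.*-identityʳ _
    ... | false | true  | _     = ℤ.*-identityˡ _
    ... | false | false | _     = refl

  ∑cube-χ-empty : (T : Fin m → Bool) → (∀ e → T e ≡ false) → ∑cube (χ T) ≡ + (2 ^ m)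
  ∑cube-χ-empty {zero} T _ = refl
  ∑cube-χ-empty {suc m} T T≗∅ rewrite T≗∅ zero =
    trans (cong₂ _+_ (trans (∑cube-cong {m} (λ s → ℤ.*-identityˡ (χ (T ∘ suc) s))) rest)
                     (trans (∑cube-cong {m} (λ s → ℤ.*-identityˡ (χ (T ∘ suc) s))) rest))
          (cong +_ (cong (2 ^ m ℕ.+_) (sym (ℕ.+-identityʳ (2 ^ m)))))
    where
    rest = ∑cube-χ-empty (T ∘ suc) (T≗∅ ∘ suc)

  -- Summing over the coordinate e, where χ T changes sign, cancels every term.
  ∑cube-χ-nonempty : (T : Fin m → Bool) (e : Fin m) → T e ≡ true → ∑cube (χ T) ≡ 0ℤ
  ∑cube-χ-nonempty {suc m} T zero Te rewrite Te =
    trans (cong₂ _+_ (∑cube-cong {m} (λ s → ℤ.*-identityˡ (χ (T ∘ suc) s)))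
                     (trans (∑cube-cong {m} (λ s → ℤ.-1*i≡-i (χ (T ∘ suc) s))) (negate (χ (T ∘ suc)))))
          (ℤ.+-inverseʳ (∑cube (χ (T ∘ suc))))
    where
    negate : (f : Signing m → ℤ) → ∑cube (λ s → - f s) ≡ - ∑cube f
    negate f = trans (∑cube-cong (λ s → sym (ℤ.-1*i≡-i (f s)))) (trans (∑cube-*ˡ -1ℤ f) (ℤ.-1*i≡-i _))
  ∑cube-χ-nonempty {suc m} T (suc e) Te = cong₂ _+_ (restricted true) (restricted false)
    where
    restricted : ∀ b → ∑cube (λ s → (if T zero then signVal b else 1ℤ) * χ (T ∘ suc) s) ≡ 0ℤ
    restricted b = trans (∑cube-*ˡ t (χ (T ∘ suc)))
      (trans (cong (t *_) (∑cube-χ-nonempty (T ∘ suc) e Te)) (ℤ.*-zeroʳ t))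
      where
      t = if T zero then signVal b else 1ℤ

  open BooleanFolds

  ∑cube-χ : (T : Fin m → Bool) → ∑cube (χ T) ≡ (if allᵇ (not ∘ T) then + (2 ^ m) else 0ℤ)
  ∑cube-χ T with allᵇ (not ∘ T) in empty
  ... | true = ∑cube-χ-empty T λ e → not-true (allᵇ-elim (not ∘ T) empty e)
    where
    not-true : ∀ {b} → not b ≡ true → b ≡ false
    not-true {false} _ = refl
  ... | false with e , ¬Te≡false ← allᵇ-counterexample (not ∘ T) empty = ∑cube-χ-nonempty T e (not-false ¬Te≡false)
    where
    not-false : ∀ {b} → not b ≡ false → b ≡ true
    not-false {true} _ = refl

  ∏-if-χ : ∀ {k} (b : Fin k → Bool) (Q : Fin k → Fin m → Bool) (s : Signing m) →
    ∏ (λ i → if b i then χ (Q i) s else 0ℤ) ≡ (if allᵇ b then χ (λ e → parity (λ i → Q i e)) s else 0ℤ)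
  ∏-if-χ {m} {zero} b Q s = sym (∏-ones {m} _ λ _ → refl)
  ∏-if-χ {k = suc k} b Q s with b zero
  ... | false = ℤ.*-zeroˡ (∏ λ i → if b (suc i) then χ (Q (suc i)) s else 0ℤ)
  ... | true = trans (cong (χ (Q zero) s *_) (∏-if-χ (b ∘ suc) (Q ∘ suc) s)) (by-rest (allᵇ (b ∘ suc)))
    where
    by-rest : ∀ c → χ (Q zero) s * (if c then χ (λ e → parity (λ i → Q (suc i) e)) s else 0ℤ)
                    ≡ (if c then χ (λ e → parity (λ i → Q i e)) s else 0ℤ)
    by-rest true = χ-xor (Q zero) _ s
    by-rest false = ℤ.*-zeroʳ (χ (Q zero) s)

  sum-at-most-one : (J : Fin m → Bool) (w : Fin m → ℤ) → (∀ e e′ → J e ≡ true → J e′ ≡ true → e ≡ e′) →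
    sumℤ m (λ e → if J e then w e else 0ℤ) ≡ (if anyᵇ J then ∏ (λ e → if J e then w e else 1ℤ) else 0ℤ)
  sum-at-most-one {zero} J w unique = refl
  sum-at-most-one {suc m} J w unique with J zero in J₀
  ... | true = begin
    w zero + sumℤ m (λ e → if J (suc e) then w (suc e) else 0ℤ)
      ≡⟨ cong (λ x → w zero + x) (trans (sumℤ-cong m (λ e → cong (if_then w (suc e) else 0ℤ) (rest e))) (sumℤ-zeros m)) ⟩
    w zero + 0ℤ
      ≡⟨ trans (ℤ.+-identityʳ (w zero)) (sym (ℤ.*-identityʳ (w zero))) ⟩
    w zero * 1ℤ
      ≡⟨ cong (w zero *_) (∏-ones {m} _ λ e → cong (if_then w (suc e) else 1ℤ) (rest e)) ⟨
    w zero * ∏ (λ e → if J (suc e) then w (suc e) else 1ℤ) ∎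
    where
    open ≡-Reasoning
    rest : ∀ e → J (suc e) ≡ false
    rest e with J (suc e) in J₁
    ... | true with () ← unique zero (suc e) J₀ J₁
    ... | false = refl
  ... | false = trans (ℤ.+-identityˡ _) (trans (sum-at-most-one (J ∘ suc) (w ∘ suc) unique′) (by-rest (anyᵇ (J ∘ suc))))
    where
    unique′ : ∀ e e′ → J (suc e) ≡ true → J (suc e′) ≡ true → e ≡ e′
    unique′ e e′ Je Je′ = Fin.suc-injective (unique (suc e) (suc e′) Je Je′)
    by-rest : ∀ c → (if c then ∏ (λ e → if J (suc e) then w (suc e) else 1ℤ) else 0ℤ)
                    ≡ (if c then 1ℤ * ∏ (λ e → if J (suc e) then w (suc e) else 1ℤ) else 0ℤ)
    by-rest true = sym (ℤ.*-identityˡ _)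
    by-rest false = refl

module Edges {n m : ℕ} (G : SimpleGraph n m) where

  open import Data.Bool using (true; false; _∧_; _∨_)
  import Data.Bool.Properties as Bool
  open import Data.Fin using (Fin; _≟_)
  open import Data.Fin.Permutation using (Permutation′; _⟨$⟩ʳ_)
  open import Data.Product using (Σ; _×_; _,_; proj₁; proj₂)
  open import Data.Sum using (_⊎_; inj₁; inj₂)
  open import Data.Empty using (⊥-elim)
  open import Function using (_∘_)
  open import Relation.Nullary using (yes; no)
  open import Relation.Binary.PropositionalEquality
  open BooleanEquality

  end₁ end₂ : Fin m → Fin n
  end₁ e = proj₁ (ends G e)
  end₂ e = proj₂ (ends G e)

  Joins : Fin m → Fin n → Fin n → Set
  Joins e i j = (end₁ e ≡ i × end₂ e ≡ j) ⊎ (end₁ e ≡ j × end₂ e ≡ i)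

  joins-≡ᵇ : ∀ e i j → joins G e i j ≡ ((end₁ e ≡ᵇ i) ∧ (end₂ e ≡ᵇ j)) ∨ ((end₁ e ≡ᵇ j) ∧ (end₂ e ≡ᵇ i))
  joins-≡ᵇ e i j with end₁ e ≡ᵇ i | end₂ e ≡ᵇ j | end₁ e ≡ᵇ j | end₂ e ≡ᵇ i
  ... | true  | true  | _     | _     = refl
  ... | true  | false | true  | true  = refl
  ... | true  | false | true  | false = refl
  ... | true  | false | false | _     = refl
  ... | false | _     | true  | true  = refl
  ... | false | _     | true  | false = refl
  ... | false | _     | false | _     = refl

  end₁≢end₂ : ∀ e → end₁ e ≢ end₂ e
  end₁≢end₂ = noLoops G

  private

    ∨-∧-true : ∀ {a b c d} → (a ∧ b) ∨ (c ∧ d) ≡ true → (a ≡ true × b ≡ true) ⊎ (c ≡ true × d ≡ true)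
    ∨-∧-true {true} {true} _ = inj₁ (refl , refl)
    ∨-∧-true {true} {false} {true} {true} _ = inj₂ (refl , refl)
    ∨-∧-true {false} {_} {true} {true} _ = inj₂ (refl , refl)

  joins⇒Joins : ∀ {e i j} → joins G e i j ≡ true → Joins e i j
  joins⇒Joins {e} {i} {j} e-joins with ∨-∧-true (trans (sym (joins-≡ᵇ e i j)) e-joins)
  ... | inj₁ (end₁≡i , end₂≡j) = inj₁ (≡ᵇ⇒≡ end₁≡i , ≡ᵇ⇒≡ end₂≡j)
  ... | inj₂ (end₁≡j , end₂≡i) = inj₂ (≡ᵇ⇒≡ end₁≡j , ≡ᵇ⇒≡ end₂≡i)

  joins-sym : ∀ e i j → joins G e i j ≡ joins G e j i
  joins-sym e i j = trans (joins-≡ᵇ e i j)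
    (trans (Bool.∨-comm ((end₁ e ≡ᵇ i) ∧ (end₂ e ≡ᵇ j)) ((end₁ e ≡ᵇ j) ∧ (end₂ e ≡ᵇ i))) (sym (joins-≡ᵇ e j i)))

  joins-irrefl : ∀ e i → joins G e i i ≢ true
  joins-irrefl e i e-joins with joins⇒Joins e-joins
  ... | inj₁ (end₁≡i , end₂≡i) = end₁≢end₂ e (trans end₁≡i (sym end₂≡i))
  ... | inj₂ (end₁≡i , end₂≡i) = end₁≢end₂ e (trans end₁≡i (sym end₂≡i))

  joins-unique : ∀ {e e′ i j} → joins G e i j ≡ true → joins G e′ i j ≡ true → e ≡ e′
  joins-unique {e} {e′} e-joins e′-joins with e ≟ e′
  ... | yes e≡e′ = e≡e′
  ... | no e≢e′ = ⊥-elim (noMulti G e e′ e≢e′ (same-ends (joins⇒Joins e-joins) (joins⇒Joins e′-joins)))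
    where
    same-ends : ∀ {i j} → Joins e i j → Joins e′ i j →
      (end₁ e ≡ end₁ e′ × end₂ e ≡ end₂ e′) ⊎ (end₁ e ≡ end₂ e′ × end₂ e ≡ end₁ e′)
    same-ends (inj₁ (p , q)) (inj₁ (r , s)) = inj₁ (trans p (sym r) , trans q (sym s))
    same-ends (inj₁ (p , q)) (inj₂ (r , s)) = inj₂ (trans p (sym s) , trans q (sym r))
    same-ends (inj₂ (p , q)) (inj₁ (r , s)) = inj₂ (trans p (sym s) , trans q (sym r))
    same-ends (inj₂ (p , q)) (inj₂ (r , s)) = inj₁ (trans p (sym r) , trans q (sym s))

  joins-from-end₁ : ∀ e w → joins G e (end₁ e) w ≡ (end₂ e ≡ᵇ w)
  joins-from-end₁ e w rewrite joins-≡ᵇ e (end₁ e) w | ≡⇒≡ᵇ {x = end₁ e} refl | ≢⇒≡ᵇ (end₁≢end₂ e ∘ sym) =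
    trans (cong ((end₂ e ≡ᵇ w) ∨_) (Bool.∧-zeroʳ _)) (Bool.∨-identityʳ _)

  joins-from-end₂ : ∀ e w → joins G e (end₂ e) w ≡ (end₁ e ≡ᵇ w)
  joins-from-end₂ e w rewrite joins-≡ᵇ e (end₂ e) w | ≡⇒≡ᵇ {x = end₂ e} refl | ≢⇒≡ᵇ (end₁≢end₂ e) =
    Bool.∧-identityʳ _

  AlongEdges : Permutation′ n → Set
  AlongEdges σ = ∀ i → Σ (Fin m) λ e → joins G e i (σ ⟨$⟩ʳ i) ≡ true

  joins-elsewhere : ∀ e {i} w → i ≢ end₁ e → i ≢ end₂ e → joins G e i w ≡ false
  joins-elsewhere e {i} w i≢end₁ i≢end₂ rewrite joins-≡ᵇ e i w | ≢⇒≡ᵇ (i≢end₁ ∘ sym) | ≢⇒≡ᵇ (i≢end₂ ∘ sym) =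
    Bool.∧-zeroʳ _


module SignedAdjacency {n m : ℕ} (G : SimpleGraph n m) where

  open import Data.Nat as ℕ using (ℕ; _^_)
  import Data.Nat.Properties as ℕ
  open import Data.Integer as ℤ using (ℤ; +_; _*_; 0ℤ; 1ℤ; _≤_; _<_; +≤+; +<+)
  import Data.Integer.Properties as ℤ
  open import Data.Integer.Tactic.RingSolver using (solve-∀)
  open import Data.Bool using (Bool; true; false; if_then_else_; not; _∧_; _xor_)
  import Data.Bool.Properties as Bool
  open import Data.Fin using (Fin)
  open import Data.Fin.Permutation using (Permutation′; _⟨$⟩ʳ_)
  open import Data.Product using (_×_; _,_; proj₁; proj₂)
  open import Data.Sum using (inj₁; inj₂)
  open import Data.Empty using (⊥-elim)
  open import Relation.Nullary using (¬_)
  open import Relation.Binary.PropositionalEquality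
  open BooleanCube using (Vanishes)
  open BooleanFolds
  open Characters
  open Sums
  open Sign using (∏; ∏-cong; sign; sign-IsSign)
  open Leibniz
  open BooleanEquality
  open CycleShape
  open Edges G

  adjacent : Fin n → Fin n → Bool
  adjacent i j = anyᵇ λ e → joins G e i j

  entry : ∀ s i j → signedAdj G s i j ≡ (if adjacent i j then χ (λ e → joins G e i j) s else 0ℤ)
  entry s i j = sum-at-most-one (λ e → joins G e i j) (λ e → signVal (s e)) (λ _ _ → joins-unique)

  -- The edges used an odd number of times by the terms i ↦ σ i of the Leibniz expansion.
  traversed : (Fin n → Fin n) → Fin m → Bool
  traversed σ e = parity λ i → joins G e i (σ i)

  ∏-signedAdj : ∀ s (σ : Fin n → Fin n) →
    ∏ (λ i → signedAdj G s i (σ i)) ≡ (if allᵇ (λ i → adjacent i (σ i)) then χ (traversed σ) s else 0ℤ)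
  ∏-signedAdj s σ = trans (∏-cong (λ i → entry s i (σ i))) (∏-if-χ _ (λ i e → joins G e i (σ i)) s)

  traversed-oddEdge : ∀ (π : Permutation′ n) e → traversed (π ⟨$⟩ʳ_) e ≡ oddEdge π (end₁ e) (end₂ e)
  traversed-oddEdge π e =
    trans (parity-pair _ (end₁≢end₂ e) λ i i≢end₁ i≢end₂ → joins-elsewhere e _ i≢end₁ i≢end₂)
          (cong₂ _xor_ (trans (joins-from-end₁ e _) (≡ᵇ-sym _ _)) (trans (joins-from-end₂ e _) (≡ᵇ-sym _ _)))

  -- π contributes to the Fourier coefficient of det ∘ signedAdj at T.
  fits : (Fin m → Bool) → Permutation′ n → Bool
  fits T π = allᵇ (λ i → adjacent i (π ⟨$⟩ʳ i)) ∧ allᵇ (λ e → not (T e xor traversed (π ⟨$⟩ʳ_) e))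

  fourier-term : ∀ T π →
    ∑cube (λ s → χ T s * ∏ (λ i → signedAdj G s i (π ⟨$⟩ʳ i))) ≡ (if fits T π then + (2 ^ m) else 0ℤ)
  fourier-term T π = trans (∑cube-cong (λ s → cong (χ T s *_) (∏-signedAdj s (π ⟨$⟩ʳ_))))
                           (by-adjacency (allᵇ (λ i → adjacent i (π ⟨$⟩ʳ i))))
    where
    X = traversed (π ⟨$⟩ʳ_)
    by-adjacency : ∀ b → ∑cube (λ s → χ T s * (if b then χ X s else 0ℤ))
                         ≡ (if b ∧ allᵇ (λ e → not (T e xor X e)) then + (2 ^ m) else 0ℤ)
    by-adjacency true = trans (∑cube-cong (χ-xor T X)) (∑cube-χ (λ e → T e xor X e))
    by-adjacency false = trans (∑cube-cong (λ s → ℤ.*-zeroʳ (χ T s))) (∑cube-Vanishes {m} (λ _ → refl))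

  fourier-det : ∀ T → ∑cube (λ s → χ T s * det n (signedAdj G s))
                      ≡ ∑ᴸ (λ c → sign (decode c ⟨$⟩ʳ_) * (if fits T (decode c) then + (2 ^ m) else 0ℤ))
  fourier-det T = begin
    ∑cube (λ s → χ T s * det n (signedAdj G s))
      ≡⟨ ∑cube-cong (λ s → trans (cong (χ T s *_) (leibniz n (signedAdj G s))) (*-distribˡ-∑ᴸ {n} (χ T s) _)) ⟩
    ∑cube (λ s → ∑ᴸ (λ c → χ T s * (sign (decode c ⟨$⟩ʳ_) * term c s)))
      ≡⟨ ∑cube-∑ᴸ (λ c s → χ T s * (sign (decode c ⟨$⟩ʳ_) * term c s)) ⟩
    ∑ᴸ (λ c → ∑cube (λ s → χ T s * (sign (decode c ⟨$⟩ʳ_) * term c s)))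
      ≡⟨ ∑ᴸ-cong {n} (λ c → trans (∑cube-cong λ s → swap (χ T s) (sign (decode c ⟨$⟩ʳ_)) (term c s))
                                  (∑cube-*ˡ (sign (decode c ⟨$⟩ʳ_)) λ s → χ T s * term c s)) ⟩
    ∑ᴸ (λ c → sign (decode c ⟨$⟩ʳ_) * ∑cube (λ s → χ T s * term c s))
      ≡⟨ ∑ᴸ-cong {n} (λ c → cong (sign (decode c ⟨$⟩ʳ_) *_) (fourier-term T (decode c))) ⟩
    ∑ᴸ (λ c → sign (decode c ⟨$⟩ʳ_) * (if fits T (decode c) then + (2 ^ m) else 0ℤ)) ∎
    where
    open ≡-Reasoning
    term : LehmerCode n → Signing m → ℤ
    term c s = ∏ λ i → signedAdj G s i (decode c ⟨$⟩ʳ i)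
    swap : ∀ a b c → a * (b * c) ≡ b * (a * c)
    swap = solve-∀

  module _ {T : Fin m → Bool} {π : Permutation′ n} (π-fits : fits T π ≡ true) where

    private
      ∧-true : ∀ {a b} → a ∧ b ≡ true → a ≡ true × b ≡ true
      ∧-true {true} {true} _ = refl , refl

    fits-adjacent : ∀ i → adjacent i (π ⟨$⟩ʳ i) ≡ true
    fits-adjacent = allᵇ-elim _ (proj₁ (∧-true π-fits))

    fits-traversed : ∀ e → T e ≡ traversed (π ⟨$⟩ʳ_) e
    fits-traversed e = xor-false (not-true (allᵇ-elim _ (proj₂ (∧-true π-fits)) e))
      where
      not-true : ∀ {b} → not b ≡ true → b ≡ false
      not-true {false} _ = refl
      xor-false : ∀ {a b} → a xor b ≡ false → a ≡ b
      xor-false {true} {true} _ = refl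
      xor-false {false} {false} _ = refl

    fits-moves : ∀ y → fixed π y ≡ false
    fits-moves y with fixed π y in y-fixed
    ... | false = refl
    ... | true with e , e-joins ← anyᵇ-witness _ (fits-adjacent y) =
      ⊥-elim (joins-irrefl e y (subst (λ w → joins G e y w ≡ true) (≡ᵇ⇒≡ y-fixed) e-joins))

    oddEdge-nonadjacent : ∀ {y z} → adjacent y z ≡ false → oddEdge π y z ≡ false
    oddEdge-nonadjacent {y} {z} no-edge =
      cong₂ _xor_ (≢⇒≡ᵇ (not-image y z none)) (≢⇒≡ᵇ (not-image z y λ e → trans (joins-sym e z y) (none e)))
      where
      none : ∀ e → joins G e y z ≡ false
      none = anyᵇ-none _ no-edge
      not-image : ∀ a b → (∀ e → joins G e a b ≡ false) → π ⟨$⟩ʳ a ≢ b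
      not-image a b none πa≡b with e , e-joins ← anyᵇ-witness _ (fits-adjacent a) =
        true≢false (trans (sym (subst (λ w → joins G e a w ≡ true) πa≡b e-joins)) (none e))

    oddEdge-edge : ∀ {e y z} → joins G e y z ≡ true → oddEdge π y z ≡ traversed (π ⟨$⟩ʳ_) e
    oddEdge-edge {e} e-joins with joins⇒Joins e-joins
    ... | inj₁ (refl , refl) = sym (traversed-oddEdge π e)
    ... | inj₂ (refl , refl) = trans (oddEdge-sym π _ _) (sym (traversed-oddEdge π e))

  fits-SameShape : ∀ {T π π′} → fits T π ≡ true → fits T π′ ≡ true → SameShape π π′
  fits-SameShape {T} {π} {π′} π-fits π′-fits = record
    { oddEdges = odd-edges
    ; fixedPoints = λ y → trans (fits-moves {T} {π} π-fits y) (sym (fits-moves {T} {π′} π′-fits y))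
    }
    where
    odd-edges : ∀ y z → oddEdge π y z ≡ oddEdge π′ y z
    odd-edges y z with adjacent y z in adj
    ... | false = trans (oddEdge-nonadjacent {T} {π} π-fits adj) (sym (oddEdge-nonadjacent {T} {π′} π′-fits adj))
    ... | true with e , e-joins ← anyᵇ-witness _ adj = begin
      oddEdge π y z              ≡⟨ oddEdge-edge {T} {π} π-fits e-joins ⟩
      traversed (π ⟨$⟩ʳ_) e      ≡⟨ fits-traversed {T} {π} π-fits e ⟨
      T e                        ≡⟨ fits-traversed {T} {π′} π′-fits e ⟩
      traversed (π′ ⟨$⟩ʳ_) e     ≡⟨ oddEdge-edge {T} {π′} π′-fits e-joins ⟨
      oddEdge π′ y z             ∎
      where open ≡-Reasoning

  encode-fits : ∀ {σ} → AlongEdges σ → fits (traversed (σ ⟨$⟩ʳ_)) (decode (encode σ)) ≡ true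
  encode-fits {σ} σ-along-edges = cong₂ _∧_
    (allᵇ-intro _ λ i → let e , e-joins = σ-along-edges i in
      anyᵇ-intro _ e (subst (λ w → joins G e i w ≡ true) (sym (decode-encode σ i)) e-joins))
    (allᵇ-intro _ λ e → trans (cong (λ t → not (T e xor t)) (parity-cong λ i → cong (joins G e i) (decode-encode σ i)))
                               (cong not (Bool.xor-same (T e))))
    where
    T = traversed (σ ⟨$⟩ʳ_)

  -- All contributing permutations have the sign ε of c₀, so ε times the coefficient is positive.
  coefficient≢0 : ∀ {T c₀} → fits T (decode c₀) ≡ true →
    ∑ᴸ (λ c → sign (decode c ⟨$⟩ʳ_) * (if fits T (decode c) then + (2 ^ m) else 0ℤ)) ≢ 0ℤ
  coefficient≢0 {T} {c₀} c₀-fits coefficient≡0 = ℤ.<-irrefl (sym ε*coefficient≡0) (begin-strict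
    0ℤ                         <⟨ ∑ᴸ-positive _ (λ c → nonneg (fits T (decode c))) c₀ positive ⟩
    ∑ᴸ (λ c → weight c)        ≡⟨ ∑ᴸ-cong {n} normalise ⟨
    ∑ᴸ (λ c → ε * F c)         ≡⟨ *-distribˡ-∑ᴸ ε F ⟨
    ε * ∑ᴸ F                   ∎)
    where
    open ℤ.≤-Reasoning
    weight : LehmerCode n → ℤ
    weight c = if fits T (decode c) then + (2 ^ m) else 0ℤ
    F : LehmerCode n → ℤ
    F c = sign (decode c ⟨$⟩ʳ_) * weight c
    ε = sign (decode c₀ ⟨$⟩ʳ_)
    normalise : ∀ c → ε * F c ≡ weight c
    normalise c with fits T (decode c) in c-fits
    ... | true = begin-equality
      ε * (sign (decode c ⟨$⟩ʳ_) * + (2 ^ m))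
        ≡⟨ cong (λ x → ε * (x * + (2 ^ m))) (sign-SameShape (fits-SameShape {T} {decode c} {decode c₀} c-fits c₀-fits)) ⟩
      ε * (ε * + (2 ^ m))       ≡⟨ ℤ.*-assoc ε ε _ ⟨
      ε * ε * + (2 ^ m)         ≡⟨ cong (_* + (2 ^ m)) (sign-IsSign (decode c₀ ⟨$⟩ʳ_)) ⟩
      1ℤ * + (2 ^ m)            ≡⟨ ℤ.*-identityˡ _ ⟩
      + (2 ^ m)                 ∎
    ... | false = trans (cong (ε *_) (ℤ.*-zeroʳ (sign (decode c ⟨$⟩ʳ_)))) (ℤ.*-zeroʳ ε)
    nonneg : ∀ b → 0ℤ ≤ (if b then + (2 ^ m) else 0ℤ)
    nonneg true = +≤+ ℕ.z≤n
    nonneg false = ℤ.≤-refl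
    positive : 0ℤ < weight c₀
    positive rewrite c₀-fits = +<+ (ℕ.m^n>0 2 m)
    ε*coefficient≡0 : ε * ∑ᴸ F ≡ 0ℤ
    ε*coefficient≡0 = trans (cong (ε *_) coefficient≡0) (ℤ.*-zeroʳ ε)

  det-not-Vanishes : ∀ σ → AlongEdges σ → ¬ Vanishes (λ s → det n (signedAdj G s))
  det-not-Vanishes σ σ-along-edges det≗0 = coefficient≢0 {T} {encode σ} (encode-fits {σ} σ-along-edges)
    (trans (sym (fourier-det T)) (∑cube-Vanishes λ s → trans (cong (χ T s *_) (det≗0 s)) (ℤ.*-zeroʳ (χ T s))))
    where
    T = traversed (σ ⟨$⟩ʳ_)

module TwoRegular where

  open import Data.Nat using (ℕ; zero; suc; _+_; _*_; _≤_; z≤n; s≤s)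
  import Data.Nat.Properties as ℕ
  open import Data.Nat.Tactic.RingSolver using (solve-∀)
  open import Data.Bool using (if_then_else_)
  open import Data.Fin using (Fin; zero; suc; _≟_)
  import Data.Fin.Properties as Fin
  open import Data.Fin.Permutation as Perm using (Permutation′; _⟨$⟩ʳ_; _∘ₚ_; lift₀; transpose)
  import Data.Fin.Permutation.Components as PC
  open import Data.Product using (Σ; ∃; ∃₂; _×_; _,_)
  open import Data.Sum using (_⊎_; inj₁; inj₂)
  open import Data.Empty using (⊥-elim)
  open import Function using (_∘_)
  open import Relation.Nullary using (Dec; yes; no)
  open import Relation.Binary.PropositionalEquality
  open BooleanEquality using (_≡ᵇ_; ≡⇒≡ᵇ; ≢⇒≡ᵇ; ≡ᵇ-sym)
  open PermutationFacts using (⟨$⟩ʳ-injective; transpose-j; transpose-other)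

  private
    variable
      n : ℕ

  sumℕ-cong : ∀ n {f g : Fin n → ℕ} → f ≗ g → sumℕ n f ≡ sumℕ n g
  sumℕ-cong zero f≗g = refl
  sumℕ-cong (suc n) f≗g = cong₂ _+_ (f≗g zero) (sumℕ-cong n (f≗g ∘ suc))

  sumℕ-+ : ∀ n (f g : Fin n → ℕ) → sumℕ n (λ i → f i + g i) ≡ sumℕ n f + sumℕ n g
  sumℕ-+ zero f g = refl
  sumℕ-+ (suc n) f g = trans (cong (f zero + g zero +_) (sumℕ-+ n (f ∘ suc) (g ∘ suc)))
    (interchange (f zero) (g zero) (sumℕ n (f ∘ suc)) (sumℕ n (g ∘ suc)))
    where
    interchange : ∀ a b c d → a + b + (c + d) ≡ a + c + (b + d)
    interchange = solve-∀

  sumℕ-*ˡ : ∀ n c (f : Fin n → ℕ) → sumℕ n (λ i → c * f i) ≡ c * sumℕ n f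
  sumℕ-*ˡ zero c f = sym (ℕ.*-zeroʳ c)
  sumℕ-*ˡ (suc n) c f = trans (cong (c * f zero +_) (sumℕ-*ˡ n c (f ∘ suc))) (sym (ℕ.*-distribˡ-+ c (f zero) _))

  sumℕ-zeros : ∀ n → sumℕ n (λ _ → 0) ≡ 0
  sumℕ-zeros zero = refl
  sumℕ-zeros (suc n) = sumℕ-zeros n

  sumℕ-comm : ∀ n k (F : Fin n → Fin k → ℕ) → sumℕ n (λ i → sumℕ k (F i)) ≡ sumℕ k (λ j → sumℕ n (λ i → F i j))
  sumℕ-comm zero k F = sym (sumℕ-zeros k)
  sumℕ-comm (suc n) k F = trans (cong (sumℕ k (F zero) +_) (sumℕ-comm n k (F ∘ suc))) (sym (sumℕ-+ k (F zero) _))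


  sumℕ-positive : ∀ n (f : Fin n → ℕ) → 1 ≤ sumℕ n f → Σ (Fin n) λ i → 1 ≤ f i
  sumℕ-positive (suc n) f pos with f zero in f₀
  ... | suc _ = zero , subst (1 ≤_) (sym f₀) (s≤s z≤n)
  ... | zero with i , fᵢ>0 ← sumℕ-positive n (f ∘ suc) pos = suc i , fᵢ>0

  sumℕ-≡0 : ∀ n (f : Fin n → ℕ) → sumℕ n f ≡ 0 → ∀ i → f i ≡ 0
  sumℕ-≡0 (suc n) f sum≡0 zero = ℕ.m+n≡0⇒m≡0 (f zero) sum≡0
  sumℕ-≡0 (suc n) f sum≡0 (suc i) = sumℕ-≡0 n (f ∘ suc) (ℕ.m+n≡0⇒n≡0 (f zero) sum≡0) i

  δ : Fin n → Fin n → ℕ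
  δ a b = if a ≡ᵇ b then 1 else 0

  δ-refl : (a : Fin n) → δ a a ≡ 1
  δ-refl a = cong (if_then 1 else 0) (≡⇒≡ᵇ {x = a} refl)

  δ-≢ : {a b : Fin n} → a ≢ b → δ a b ≡ 0
  δ-≢ a≢b = cong (if_then 1 else 0) (≢⇒≡ᵇ a≢b)

  δ-sym : (a b : Fin n) → δ a b ≡ δ b a
  δ-sym a b = cong (if_then 1 else 0) (≡ᵇ-sym a b)

  δ-suc : (a b : Fin n) → δ (suc a) (suc b) ≡ δ a b
  δ-suc a b = by-cases (a ≟ b)
    where
    by-cases : Dec (a ≡ b) → δ (suc a) (suc b) ≡ δ a b
    by-cases (yes refl) = trans (δ-refl (suc a)) (sym (δ-refl a))
    by-cases (no a≢b) = trans (δ-≢ (a≢b ∘ Fin.suc-injective)) (sym (δ-≢ a≢b))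


  sumℕ-δ : ∀ n (t : Fin n) → sumℕ n (λ j → δ j t) ≡ 1
  sumℕ-δ (suc n) zero = cong₂ _+_ (δ-refl {suc n} zero) (sumℕ-zeros n)
  sumℕ-δ (suc n) (suc t) = trans (sumℕ-cong n (λ j → δ-suc j t)) (sumℕ-δ n t)

  sumℕ-≡1 : ∀ n (f : Fin n → ℕ) → sumℕ n f ≡ 1 → ∃ λ t → ∀ j → f j ≡ δ j t
  sumℕ-≡1 (suc n) f sum≡1 with f zero in f₀
  ... | zero with t , f≗δ ← sumℕ-≡1 n (f ∘ suc) sum≡1 = suc t , λ where
    zero → f₀
    (suc j) → trans (f≗δ j) (sym (δ-suc j t))
  ... | suc zero = zero , λ where
    zero → trans f₀ (sym (δ-refl {suc n} zero))
    (suc j) → sumℕ-≡0 n (f ∘ suc) (ℕ.suc-injective sum≡1) j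
  ... | suc (suc _) with () ← sum≡1

  sumℕ-≡2 : ∀ n (f : Fin n → ℕ) → sumℕ n f ≡ 2 → ∃₂ λ u t → ∀ j → f j ≡ δ j u + δ j t
  sumℕ-≡2 (suc n) f sum≡2 with f zero in f₀
  ... | zero with u , t , f≗δ ← sumℕ-≡2 n (f ∘ suc) sum≡2 = suc u , suc t , λ where
    zero → f₀
    (suc j) → trans (f≗δ j) (sym (cong₂ _+_ (δ-suc j u) (δ-suc j t)))
  ... | suc zero with t , f≗δ ← sumℕ-≡1 n (f ∘ suc) (ℕ.suc-injective sum≡2) = zero , suc t , λ where
    zero → trans f₀ (sym (cong (_+ 0) (δ-refl {suc n} zero)))
    (suc j) → trans (f≗δ j) (sym (δ-suc j t))
  ... | suc (suc zero) = zero , zero , λ where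
    zero → trans f₀ (sym (cong₂ _+_ (δ-refl {suc n} zero) (δ-refl {suc n} zero)))
    (suc j) → sumℕ-≡0 n (f ∘ suc) (ℕ.suc-injective (ℕ.suc-injective sum≡2)) j
  ... | suc (suc (suc _)) with () ← sum≡2

  sumℕ-≡2-head : ∀ n (f : Fin (suc n) → ℕ) → sumℕ (suc n) f ≡ 2 → f zero ≡ 2 → ∀ j → f (suc j) ≡ 0
  sumℕ-≡2-head n f sum≡2 f₀≡2 =
    sumℕ-≡0 n (f ∘ suc) (ℕ.+-cancelˡ-≡ 2 _ 0 (trans (cong (_+ sumℕ n (f ∘ suc)) (sym f₀≡2)) sum≡2))

  -- X is the adjacency matrix of a 2-regular multigraph on Fin n, a loop counting twice.
  record TwoRegular (X : Fin n → Fin n → ℕ) : Set where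
    field
      symmetric : ∀ i j → X i j ≡ X j i
      loops : ∀ i → X i i ≡ 0 ⊎ X i i ≡ 2
      degree : ∀ i → sumℕ n (X i) ≡ 2
  open TwoRegular

  -- X i j counts how often the cycles of σ pass between i and j.
  Traverses : Permutation′ n → (Fin n → Fin n → ℕ) → Set
  Traverses σ X = ∀ i j → X i j ≡ δ (σ ⟨$⟩ʳ i) j + δ (σ ⟨$⟩ʳ j) i

  private
    -- Vertex zero, with neighbours u and t, is replaced by an edge between u and t.
    contract : (Fin (suc n) → Fin (suc n) → ℕ) → Fin n → Fin n → Fin n → Fin n → ℕ
    contract X u t i j = X (suc i) (suc j) + (δ i u * δ j t + δ i t * δ j u)

    module Contraction (X : Fin (suc n) → Fin (suc n) → ℕ) (R : TwoRegular X) (no-loop : X zero zero ≡ 0)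
                       (u t : Fin n) (row₀ : ∀ j → X zero (suc j) ≡ δ j u + δ j t) where

      column₀ : ∀ i → X (suc i) zero ≡ δ i u + δ i t
      column₀ i = trans (symmetric R (suc i) zero) (row₀ i)

      contract-TwoRegular : TwoRegular (contract X u t)
      contract-TwoRegular = record
        { symmetric = λ i j → cong₂ _+_ (symmetric R (suc i) (suc j)) (swap (δ i u) (δ j t) (δ i t) (δ j u))
        ; loops = loops′
        ; degree = degree′
        }
        where
        swap : ∀ a b c d → a * b + c * d ≡ d * c + b * a
        swap = solve-∀
        degree′ : ∀ i → sumℕ n (contract X u t i) ≡ 2
        degree′ i = begin
          sumℕ n (contract X u t i)
            ≡⟨ sumℕ-+ n (λ j → X (suc i) (suc j)) _ ⟩
          sumℕ n (λ j → X (suc i) (suc j)) + sumℕ n (λ j → δ i u * δ j t + δ i t * δ j u)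
            ≡⟨ cong (sumℕ n (λ j → X (suc i) (suc j)) +_)
                 (trans (sumℕ-+ n (λ j → δ i u * δ j t) (λ j → δ i t * δ j u)) (cong₂ _+_ (row-sum u t) (row-sum t u))) ⟩
          sumℕ n (λ j → X (suc i) (suc j)) + (δ i u + δ i t)
            ≡⟨ trans (cong (sumℕ n (λ j → X (suc i) (suc j)) +_) (sym (column₀ i))) (ℕ.+-comm _ (X (suc i) zero)) ⟩
          X (suc i) zero + sumℕ n (λ j → X (suc i) (suc j))
            ≡⟨ degree R (suc i) ⟩
          2 ∎
          where
          open ≡-Reasoning
          row-sum : ∀ k l → sumℕ n (λ j → δ i k * δ j l) ≡ δ i k
          row-sum k l = trans (sumℕ-*ˡ n (δ i k) (λ j → δ j l))
                              (trans (cong (δ i k *_) (sumℕ-δ n l)) (ℕ.*-identityʳ (δ i k)))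
        loops′ : ∀ i → contract X u t i i ≡ 0 ⊎ contract X u t i i ≡ 2
        loops′ i = by-cases (i ≟ u) (i ≟ t)
          where
          unchanged : δ i u * δ i t ≡ 0 → contract X u t i i ≡ X (suc i) (suc i)
          unchanged uut≡0 =
            trans (cong (X (suc i) (suc i) +_) (cong₂ _+_ uut≡0 (trans (ℕ.*-comm (δ i t) (δ i u)) uut≡0))) (ℕ.+-identityʳ _)
          by-cases : Dec (i ≡ u) → Dec (i ≡ t) → contract X u t i i ≡ 0 ⊎ contract X u t i i ≡ 2
          by-cases (yes refl) (yes refl) =
            inj₂ (cong₂ _+_ no-self-loop (cong₂ (λ a b → a * a + a * a) (δ-refl i) (δ-refl i)))
            where
            no-self-loop : X (suc i) (suc i) ≡ 0
            no-self-loop = sumℕ-≡2-head n (X (suc i)) (degree R (suc i))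
                             (trans (column₀ i) (cong₂ _+_ (δ-refl i) (δ-refl i))) i
          by-cases (no i≢u) _ =
            subst (λ k → k ≡ 0 ⊎ k ≡ 2) (sym (unchanged (cong (_* δ i t) (δ-≢ i≢u)))) (loops R (suc i))
          by-cases (yes _) (no i≢t) =
            subst (λ k → k ≡ 0 ⊎ k ≡ 2) (sym (unchanged (trans (cong (δ i u *_) (δ-≢ i≢t)) (ℕ.*-zeroʳ (δ i u)))))
              (loops R (suc i))

      -- Undoing the contraction: zero is inserted between u and its successor t.
      insert-Traverses : (σ′ : Permutation′ n) → σ′ ⟨$⟩ʳ u ≡ t → Traverses σ′ (contract X u t) →
        Traverses (lift₀ σ′ ∘ₚ transpose zero (suc t)) X
      insert-Traverses σ′ σ′u≡t σ′-traverses = traverses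
        where
        σ = lift₀ σ′ ∘ₚ transpose zero (suc t)
        at-suc : ∀ i → (i ≡ u × σ ⟨$⟩ʳ suc i ≡ zero) ⊎ (i ≢ u × σ ⟨$⟩ʳ suc i ≡ suc (σ′ ⟨$⟩ʳ i))
        at-suc i with i ≟ u
        ... | yes refl = inj₁ (refl , trans (cong (PC.transpose zero (suc t) ∘ suc) σ′u≡t) (transpose-j zero (suc t)))
        ... | no i≢u = inj₂ (i≢u , transpose-other {i = zero} {suc t} (λ ()) sσ′i≢st)
          where
          sσ′i≢st : suc (σ′ ⟨$⟩ʳ i) ≢ suc t
          sσ′i≢st sσ′i≡st = i≢u (⟨$⟩ʳ-injective σ′ (trans (Fin.suc-injective sσ′i≡st) (sym σ′u≡t)))
        towards-zero : ∀ i → δ (σ ⟨$⟩ʳ suc i) zero ≡ δ i u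
        towards-zero i with at-suc i
        ... | inj₁ (refl , σsi≡0) = trans (cong (λ w → δ w zero) σsi≡0) (sym (δ-refl i))
        ... | inj₂ (i≢u , σsi≡sσ′i) = trans (cong (λ w → δ w zero) σsi≡sσ′i) (sym (δ-≢ i≢u))
        between-suc : ∀ i j → δ (σ ⟨$⟩ʳ suc i) (suc j) + δ i u * δ j t ≡ δ (σ′ ⟨$⟩ʳ i) j
        between-suc i j with at-suc i
        ... | inj₁ (refl , σsi≡0) = begin
          δ (σ ⟨$⟩ʳ suc i) (suc j) + δ i i * δ j t   ≡⟨ cong₂ (λ w k → δ w (suc j) + k * δ j t) σsi≡0 (δ-refl i) ⟩
          δ j t + 0                                  ≡⟨ trans (ℕ.+-identityʳ (δ j t)) (δ-sym j t) ⟩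
          δ t j                                      ≡⟨ cong (λ w → δ w j) σ′u≡t ⟨
          δ (σ′ ⟨$⟩ʳ i) j                            ∎
          where open ≡-Reasoning
        ... | inj₂ (i≢u , σsi≡sσ′i) = trans (cong₂ (λ w k → δ w (suc j) + k * δ j t) σsi≡sσ′i (δ-≢ i≢u))
                                            (trans (ℕ.+-identityʳ _) (δ-suc (σ′ ⟨$⟩ʳ i) j))
        traverses : Traverses σ X
        traverses zero zero = no-loop
        traverses zero (suc j) = trans (row₀ j)
          (trans (ℕ.+-comm (δ j u) (δ j t)) (cong₂ _+_ (trans (δ-sym j t) (sym (δ-suc t j))) (sym (towards-zero j))))
        traverses (suc i) zero = trans (symmetric R (suc i) zero)
          (trans (traverses zero (suc i)) (ℕ.+-comm (δ (σ ⟨$⟩ʳ zero) (suc i)) (δ (σ ⟨$⟩ʳ suc i) zero)))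
        traverses (suc i) (suc j) = ℕ.+-cancelʳ-≡ (δ i u * δ j t + δ i t * δ j u) _ _ (begin
          X (suc i) (suc j) + (δ i u * δ j t + δ i t * δ j u)
            ≡⟨ σ′-traverses i j ⟩
          δ (σ′ ⟨$⟩ʳ i) j + δ (σ′ ⟨$⟩ʳ j) i
            ≡⟨ cong₂ _+_ (between-suc i j) (between-suc j i) ⟨
          (δ (σ ⟨$⟩ʳ suc i) (suc j) + δ i u * δ j t) + (δ (σ ⟨$⟩ʳ suc j) (suc i) + δ j u * δ i t)
            ≡⟨ regroup (δ (σ ⟨$⟩ʳ suc i) (suc j)) (δ i u * δ j t) (δ (σ ⟨$⟩ʳ suc j) (suc i)) (δ j u) (δ i t) ⟩
          (δ (σ ⟨$⟩ʳ suc i) (suc j) + δ (σ ⟨$⟩ʳ suc j) (suc i)) + (δ i u * δ j t + δ i t * δ j u) ∎)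
          where
          open ≡-Reasoning
          regroup : ∀ a b c d e → (a + b) + (c + d * e) ≡ (a + c) + (b + e * d)
          regroup = solve-∀

    -- A loop at zero makes zero a fixed point and leaves a 2-regular multigraph on the other vertices.
    module Loop (X : Fin (suc n) → Fin (suc n) → ℕ) (R : TwoRegular X) (loop : X zero zero ≡ 2) where

      row₀ : ∀ j → X zero (suc j) ≡ 0
      row₀ = sumℕ-≡2-head n (X zero) (degree R zero) loop

      delete-TwoRegular : TwoRegular (λ i j → X (suc i) (suc j))
      delete-TwoRegular = record
        { symmetric = λ i j → symmetric R (suc i) (suc j)
        ; loops = loops R ∘ suc
        ; degree = λ i → trans (cong (_+ sumℕ n (λ j → X (suc i) (suc j))) (sym (trans (symmetric R (suc i) zero) (row₀ i))))
                               (degree R (suc i))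
        }

      lift-Traverses : (σ′ : Permutation′ n) → Traverses σ′ (λ i j → X (suc i) (suc j)) → Traverses (lift₀ σ′) X
      lift-Traverses σ′ σ′-traverses zero zero = loop
      lift-Traverses σ′ σ′-traverses zero (suc j) = row₀ j
      lift-Traverses σ′ σ′-traverses (suc i) zero = trans (symmetric R (suc i) zero) (row₀ i)
      lift-Traverses σ′ σ′-traverses (suc i) (suc j) =
        trans (σ′-traverses i j) (sym (cong₂ _+_ (δ-suc (σ′ ⟨$⟩ʳ i) j) (δ-suc (σ′ ⟨$⟩ʳ j) i)))

  cycle-decomposition : ∀ n (X : Fin n → Fin n → ℕ) → TwoRegular X → Σ (Permutation′ n) λ σ → Traverses σ X
  cycle-decomposition zero X R = Perm.id , λ ()
  cycle-decomposition (suc n) X R with loops R zero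
  ... | inj₂ loop =
    let σ′ , σ′-traverses = cycle-decomposition n _ (Loop.delete-TwoRegular X R loop)
    in lift₀ σ′ , Loop.lift-Traverses X R loop σ′ σ′-traverses
  ... | inj₁ no-loop
    with u , t , row₀ ← sumℕ-≡2 n (X zero ∘ suc) (trans (cong (_+ sumℕ n (X zero ∘ suc)) (sym no-loop)) (degree R zero))
    with σ′ , σ′-traverses ← cycle-decomposition n (contract X u t) (Contraction.contract-TwoRegular X R no-loop u t row₀)
    with σ′ ⟨$⟩ʳ u ≟ t | σ′ ⟨$⟩ʳ t ≟ u
  ... | yes σ′u≡t | _ =
    lift₀ σ′ ∘ₚ transpose zero (suc t) , Contraction.insert-Traverses X R no-loop u t row₀ σ′ σ′u≡t σ′-traverses
  ... | no _ | yes σ′t≡u =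
    lift₀ σ′ ∘ₚ transpose zero (suc u) ,
    Contraction.insert-Traverses X R no-loop t u (λ j → trans (row₀ j) (ℕ.+-comm (δ j u) (δ j t))) σ′ σ′t≡u
      (λ i j → trans (cong (X (suc i) (suc j) +_) (ℕ.+-comm (δ i t * δ j u) (δ i u * δ j t))) (σ′-traverses i j))
  ... | no σ′u≢t | no σ′t≢u = ⊥-elim (ℕ.<-irrefl refl (begin-strict
      0                                  <⟨ s≤s z≤n ⟩
      1                                  ≡⟨ cong₂ _*_ (δ-refl u) (δ-refl t) ⟨
      δ u u * δ t t                      ≤⟨ ℕ.m≤m+n _ _ ⟩
      δ u u * δ t t + δ u t * δ t u      ≤⟨ ℕ.m≤n+m _ (X (suc u) (suc t)) ⟩
      contract X u t u t                 ≡⟨ σ′-traverses u t ⟩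
      δ (σ′ ⟨$⟩ʳ u) t + δ (σ′ ⟨$⟩ʳ t) u  ≡⟨ cong₂ _+_ (δ-≢ σ′u≢t) (δ-≢ σ′t≢u) ⟩
      0                                  ∎))
    where open ℕ.≤-Reasoning

module TwoFactor {n m : ℕ} (G : SimpleGraph n m) where

  open import Data.Nat using (ℕ; _*_; _≤_)
  import Data.Nat.Properties as ℕ
  open import Data.Bool using (true; false; if_then_else_; _∨_)
  import Data.Bool.Properties as Bool
  open import Data.Fin using (Fin; _≟_)
  open import Data.Fin.Permutation using (Permutation′; _⟨$⟩ʳ_)
  open import Data.Product using (Σ; _,_)
  open import Data.Sum using (inj₁)
  open import Data.Empty using (⊥-elim)
  open import Function using (_∘_)
  open import Relation.Nullary using (Dec; yes; no)
  open import Relation.Binary.PropositionalEquality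
  open BooleanEquality using (_≡ᵇ_; ≡⇒≡ᵇ; ≢⇒≡ᵇ; ≡ᵇ-sym)
  open TwoRegular
  open Edges G

  incident-≡ᵇ : ∀ e w → incident G e w ≡ (end₁ e ≡ᵇ w) ∨ (end₂ e ≡ᵇ w)
  incident-≡ᵇ e w with end₁ e ≡ᵇ w | end₂ e ≡ᵇ w
  ... | true  | _     = refl
  ... | false | true  = refl
  ... | false | false = refl

  sumℕ-indicator : ∀ n (t : Fin n) c → sumℕ n (λ j → if t ≡ᵇ j then c else 0) ≡ c
  sumℕ-indicator n t c = begin
    sumℕ n (λ j → if t ≡ᵇ j then c else 0)
      ≡⟨ sumℕ-cong n (λ j → scaled-indicator (t ≡ᵇ j) (cong (if_then 1 else 0) (≡ᵇ-sym t j))) ⟩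
    sumℕ n (λ j → c * δ j t)                 ≡⟨ sumℕ-*ˡ n c (λ j → δ j t) ⟩
    c * sumℕ n (λ j → δ j t)                 ≡⟨ cong (c *_) (sumℕ-δ n t) ⟩
    c * 1                                    ≡⟨ ℕ.*-identityʳ c ⟩
    c                                        ∎
    where
    open ≡-Reasoning
    scaled-indicator : ∀ b {d} → (if b then 1 else 0) ≡ d → (if b then c else 0) ≡ c * d
    scaled-indicator true refl = sym (ℕ.*-identityʳ c)
    scaled-indicator false refl = sym (ℕ.*-zeroʳ c)

  row-of-edge : ∀ e i c → sumℕ n (λ j → if joins G e i j then c else 0) ≡ (if incident G e i then c else 0)
  row-of-edge e i c = trans (by-cases (end₁ e ≟ i) (end₂ e ≟ i)) (cong (if_then c else 0) (sym (incident-≡ᵇ e i)))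
    where
    by-cases : Dec (end₁ e ≡ i) → Dec (end₂ e ≡ i) →
      sumℕ n (λ j → if joins G e i j then c else 0) ≡ (if (end₁ e ≡ᵇ i) ∨ (end₂ e ≡ᵇ i) then c else 0)
    by-cases (yes refl) _ = begin
      sumℕ n (λ j → if joins G e i j then c else 0)
        ≡⟨ sumℕ-cong n (λ j → cong (if_then c else 0) (joins-from-end₁ e j)) ⟩
      sumℕ n (λ j → if end₂ e ≡ᵇ j then c else 0)     ≡⟨ sumℕ-indicator n (end₂ e) c ⟩
      c
        ≡⟨ cong (λ b → if b ∨ (end₂ e ≡ᵇ i) then c else 0) (≡⇒≡ᵇ {x = i} refl) ⟨
      (if (i ≡ᵇ i) ∨ (end₂ e ≡ᵇ i) then c else 0)     ∎
      where open ≡-Reasoning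
    by-cases (no _) (yes refl) = begin
      sumℕ n (λ j → if joins G e i j then c else 0)
        ≡⟨ sumℕ-cong n (λ j → cong (if_then c else 0) (joins-from-end₂ e j)) ⟩
      sumℕ n (λ j → if end₁ e ≡ᵇ j then c else 0)     ≡⟨ sumℕ-indicator n (end₁ e) c ⟩
      c
        ≡⟨ cong (if_then c else 0) (trans (cong ((end₁ e ≡ᵇ i) ∨_) (≡⇒≡ᵇ {x = i} refl)) (Bool.∨-zeroʳ _)) ⟨
      (if (end₁ e ≡ᵇ i) ∨ (i ≡ᵇ i) then c else 0)     ∎
      where open ≡-Reasoning
    by-cases (no end₁≢i) (no end₂≢i) = begin
      sumℕ n (λ j → if joins G e i j then c else 0)
        ≡⟨ sumℕ-cong n (λ j → cong (if_then c else 0) (joins-elsewhere e j (end₁≢i ∘ sym) (end₂≢i ∘ sym))) ⟩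
      sumℕ n (λ j → 0)                                ≡⟨ sumℕ-zeros n ⟩
      0
        ≡⟨ cong₂ (λ a b → if a ∨ b then c else 0) (≢⇒≡ᵇ end₁≢i) (≢⇒≡ᵇ end₂≢i) ⟨
      (if (end₁ e ≡ᵇ i) ∨ (end₂ e ≡ᵇ i) then c else 0) ∎
      where open ≡-Reasoning

  multiplicity : (Fin m → ℕ) → Fin n → Fin n → ℕ
  multiplicity x i j = sumℕ m λ e → if joins G e i j then x e else 0

  multiplicity-TwoRegular : (x : Fin m → ℕ) → (∀ v → sumℕ m (λ e → if incident G e v then x e else 0) ≡ 2) →
    TwoRegular (multiplicity x)
  multiplicity-TwoRegular x degree-two = record
    { symmetric = λ i j → sumℕ-cong m λ e → cong (if_then x e else 0) (joins-sym e i j)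
    ; loops = λ i → inj₁ (trans (sumℕ-cong m λ e → cong (if_then x e else 0) (no-loop e i)) (sumℕ-zeros m))
    ; degree = λ i → trans (sumℕ-comm n m λ j e → if joins G e i j then x e else 0)
                           (trans (sumℕ-cong m λ e → row-of-edge e i (x e)) (degree-two i))
    }
    where
    no-loop : ∀ e i → joins G e i i ≡ false
    no-loop e i with joins G e i i in loop
    ... | true = ⊥-elim (joins-irrefl e i loop)
    ... | false = refl

  along-edges : (x : Fin m → ℕ) (σ : Permutation′ n) → Traverses σ (multiplicity x) → AlongEdges σ
  along-edges x σ σ-traverses i = let e , positive = sumℕ-positive m _ used in e , joins-used positive
    where
    used : 1 ≤ multiplicity x i (σ ⟨$⟩ʳ i)
    used = subst (1 ≤_) (sym (σ-traverses i (σ ⟨$⟩ʳ i)))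
      (ℕ.≤-trans (ℕ.≤-reflexive (sym (δ-refl (σ ⟨$⟩ʳ i)))) (ℕ.m≤m+n _ _))
    joins-used : ∀ {e} → 1 ≤ (if joins G e i (σ ⟨$⟩ʳ i) then x e else 0) → joins G e i (σ ⟨$⟩ʳ i) ≡ true
    joins-used {e} with joins G e i (σ ⟨$⟩ʳ i)
    ... | true = λ _ → refl
    ... | false = λ ()

  permutation-along-edges : PerfectTwoMatching G → Σ (Permutation′ n) AlongEdges
  permutation-along-edges (x , _ , degree-two) =
    let σ , σ-traverses = cycle-decomposition n (multiplicity x) (multiplicity-TwoRegular x degree-two)
    in σ , along-edges x σ σ-traverses

open BooleanCube using (vanishes⊎count-bound)
open Determinant using (det-signedAdj-Preserves; det-signedAdj-DegreeBelow)
open SignedAdjacency using (det-not-Vanishes)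
open TwoFactor using (permutation-along-edges)
open import Data.Nat using (ℕ; _≤_; _*_; _^_; _!)
open import Data.Nat.Properties using (≤-trans; *-monoˡ-≤; m≤m*n; _!≢0)
open import Data.Product using (_,_)
open import Data.Sum using (inj₁; inj₂)
open import Data.Empty using (⊥-elim)

theorem6 : ∀ (n m : ℕ) (G : SimpleGraph n m) → PerfectTwoMatching G →
    2 ^ m ≤ numInvertibleSignings G * (n !) * 2 ^ n
theorem6 n m G matching
  with vanishes⊎count-bound n (λ s → det n (signedAdj G s)) (det-signedAdj-Preserves G) (det-signedAdj-DegreeBelow G)
... | inj₁ det≗0 =
  let σ , σ-along-edges = permutation-along-edges G matching in ⊥-elim (det-not-Vanishes G σ σ-along-edges det≗0)
... | inj₂ bound = ≤-trans bound (*-monoˡ-≤ (2 ^ n) (m≤m*n (numInvertibleSignings G) (n !) {{n !≢0}}))
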